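{- Let $r>1$, let $\lambda$ be a partition, $i$ a color, and $\blacksquare\in A_i(\lambda)$. Then \[ \left(\frac{N_{\lambda\cup\blacksquare}}{N_\lambda}\right)\frac{\prod_{\square\in R_i(\lambda\cup\blacksquare)}\left(1-qt\frac{\chi_\square}{\chi_\blacksquare}\right)}{\prod_{\square\in A_i(\lambda\cup\blacksquare)}\left(1-\frac{\chi_\square}{\chi_\blacksquare}\right)}=\frac{\prod_{\square\in A_i(\lambda)}\left(1-qt\frac{\chi_\blacksquare}{\chi_\square}\right)}{\prod_{\square\in R_i(\lambda)}\left(1-\frac{\chi_\blacksquare}{\chi_\square}\right)}. \]
   Context: Colors are elements of $\mathbb{Z}/r\mathbb{Z}$. Young diagrams in French convention; box $\square=(a,b)$ ($a,b\ge0$) lies in column $a+1$, row $b+1$, has character $\chi_\square=q^at^b$ and color $(b-a)\bmod r$. $A_i(\lambda)$ (resp. $R_i(\lambda)$): the addable (resp. removable) corners of $\lambda$ of color $i$. For $\square=(a,b)\in\lambda$: arm $a_\lambda(\square)=\lambda_{b+1}-a-1$, leg $l_\lambda(\square)={}^t\lambda_{a+1}-b-1$ (${}^t\lambda$ the transposed partition), hook length $h_\lambda(\square)=a_\lambda(\square)+l_\lambda(\square)+1$, and $N_\lambda=\prod_{\square\in\lambda,\ h_\lambda(\square)\equiv0\bmod r}\big(1-q^{a_\lambda(\square)+1}t^{ -l_\lambda(\square)}\big)\big(1-q^{ -a_\lambda(\square)}t^{l_\lambda(\square)+1}\big)$. -}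

module Defs where

open import Level using (Level)
open import Data.Nat as ℕ using (ℕ; zero; suc; _∸_; _<_; _≤_; _<?_; _≤?_; NonZero)
open import Data.Nat.DivMod using (_%_)
open import Data.Integer as ℤ using (ℤ; +_; -[1+_]; _%ℕ_)
open import Data.Fin using (Fin; toℕ)
open import Data.Product using (_×_; _,_)
open import Data.List using (List; []; _∷_; length; foldr; map; filter; concatMap; upTo; head)
open import Data.Maybe using (Maybe; just; nothing)
open import Data.Bool using (Bool; true; false; if_then_else_)
open import Data.Sum using (_⊎_)
open import Relation.Nullary using (¬_; Dec; yes; no)
open import Relation.Nullary.Decidable using (_×-dec_; _⊎-dec_; ¬?)
open import Relation.Binary.PropositionalEquality using (_≡_)
open import Data.List.Relation.Unary.Linked using (Linked)
open import Data.List.Relation.Unary.All using (All)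
open import Algebra.Bundles using (CommutativeRing)

-- Partitions: λ = (λ₁ ≥ λ₂ ≥ … ≥ λ_ℓ > 0) as a list of row lengths.

IsPartition : List ℕ → Set
IsPartition λ' = Linked (λ x y → y ≤ x) λ' × All (λ x → 0 < x) λ'

-- Box (a , b), a,b ≥ 0: column a+1, row b+1.
Box : Set
Box = ℕ × ℕ

-- λ_{k+1} (0-indexed row k), 0 beyond the length.
row : List ℕ → ℕ → ℕ
row []       _       = 0
row (x ∷ _)  zero    = x
row (_ ∷ xs) (suc k) = row xs k

-- ᵗλ_{a+1}: number of rows of length > a.
col : List ℕ → ℕ → ℕ
col []       _ = 0
col (x ∷ xs) a with a <? x
... | yes _ = suc (col xs a)
... | no  _ = col xs a

_∈λ_ : Box → List ℕ → Set
(a , b) ∈λ λ' = a < row λ' b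

_∈λ?_ : (s : Box) (λ' : List ℕ) → Dec (s ∈λ λ')
(a , b) ∈λ? λ' = a <? row λ' b

color : (r : ℕ) .{{_ : NonZero r}} → Box → ℕ
color r (a , b) = (+ b ℤ.- + a) %ℕ r

-- addable corner: □ ∉ λ and λ ∪ {□} is again a Young diagram
Addable : List ℕ → Box → Set
Addable λ' (a , b) =
  ¬ ((a , b) ∈λ λ') × ((a ≡ 0) ⊎ ((a ∸ 1 , b) ∈λ λ')) × ((b ≡ 0) ⊎ ((a , b ∸ 1) ∈λ λ'))

Addable? : (λ' : List ℕ) (s : Box) → Dec (Addable λ' s)
Addable? λ' (a , b) =
  ¬? ((a , b) ∈λ? λ') ×-dec ((a ℕ.≟ 0) ⊎-dec ((a ∸ 1 , b) ∈λ? λ'))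
                      ×-dec ((b ℕ.≟ 0) ⊎-dec ((a , b ∸ 1) ∈λ? λ'))

-- removable corner: □ ∈ λ and λ ∖ {□} is again a Young diagram
Removable : List ℕ → Box → Set
Removable λ' (a , b) = ((a , b) ∈λ λ') × ¬ ((suc a , b) ∈λ λ') × ¬ ((a , suc b) ∈λ λ')

Removable? : (λ' : List ℕ) (s : Box) → Dec (Removable λ' s)
Removable? λ' (a , b) =
  ((a , b) ∈λ? λ') ×-dec ¬? ((suc a , b) ∈λ? λ') ×-dec ¬? ((a , suc b) ∈λ? λ')

-- all boxes (a , b) with a ≤ λ₁, b ≤ ℓ(λ): contains λ and all its
-- addable and removable corners
rect : List ℕ → List Box
rect λ' = concatMap (λ b → map (λ a → (a , b)) (upTo (suc (row λ' 0))))
                    (upTo (suc (length λ')))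

boxes : List ℕ → List Box
boxes λ' = filter (_∈λ? λ') (rect λ')

A : (r : ℕ) .{{_ : NonZero r}} → ℕ → List ℕ → List Box
A r i λ' = filter (λ s → Addable? λ' s ×-dec (color r s ℕ.≟ i)) (rect λ')

R : (r : ℕ) .{{_ : NonZero r}} → ℕ → List ℕ → List Box
R r i λ' = filter (λ s → Removable? λ' s ×-dec (color r s ℕ.≟ i)) (rect λ')

-- λ ∪ {(a , b)}: add one box to row b+1 (used for addable boxes)
addBox : List ℕ → Box → List ℕ
addBox []       (_ , zero)  = 1 ∷ []
addBox []       (a , suc b) = 0 ∷ addBox [] (a , b)
addBox (x ∷ xs) (_ , zero)  = suc x ∷ xs
addBox (x ∷ xs) (a , suc b) = x ∷ addBox xs (a , b)

arm leg : List ℕ → Box → ℕ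
arm λ' (a , b) = row λ' b ∸ a ∸ 1
leg λ' (a , b) = col λ' a ∸ b ∸ 1

hook : List ℕ → Box → ℕ
hook λ' s = arm λ' s ℕ.+ leg λ' s ℕ.+ 1

-- Expressions in a commutative ring with two units q, t
-- (q⁻¹, t⁻¹ given together with q * q⁻¹ ≈ 1, t * t⁻¹ ≈ 1).

module Expr {c ℓ : Level} (Rg : CommutativeRing c ℓ)
            (q q⁻¹ t t⁻¹ : CommutativeRing.Carrier Rg) where
  open CommutativeRing Rg

  _^_ : Carrier → ℕ → Carrier
  x ^ zero  = 1#
  x ^ suc n = x * (x ^ n)

  mono : ℤ → ℤ → Carrier
  mono m n = qpow m * tpow n
    where
    qpow tpow : ℤ → Carrier
    qpow (+ k)    = q ^ k
    qpow -[1+ k ] = q⁻¹ ^ suc k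
    tpow (+ k)    = t ^ k
    tpow -[1+ k ] = t⁻¹ ^ suc k

  prod : {A : Set} → (A → Carrier) → List A → Carrier
  prod f = foldr (λ x acc → f x * acc) 1#

  -- χ_□ / χ_■  =  q^(a-a') t^(b-b')
  ratio : Box → Box → Carrier
  ratio (a , b) (a' , b') = mono (+ a ℤ.- + a') (+ b ℤ.- + b')

  N : (r : ℕ) .{{_ : NonZero r}} → List ℕ → Carrier
  N r λ' = prod factor (filter (λ s → hook λ' s % r ℕ.≟ 0) (boxes λ'))
    where
    factor : Box → Carrier
    factor s = (1# - mono (+ suc (arm λ' s)) (ℤ.- + leg λ' s))
             * (1# - mono (ℤ.- + arm λ' s) (+ suc (leg λ' s)))

{-# OPTIONS --safe #-}
module Submission where

-- Both sides are products over boxes.  On a rectangle containing λ ∪ ■, ■ = (a₀ , b₀), write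
-- each side as a product of box-local factors (the factor of N for a box whose hook length is
-- divisible by r, and the factors of the removable and addable corners of colour i) and compare
-- the two products in the four quadrants around ■.  Below and left of ■ nothing changes.  Above
-- and right of ■ only ■ itself contributes, being a removable corner of λ ∪ ■ and an addable
-- corner of λ, with the factor 1 - qt on both sides.  Above row b₀ and left of ■ only the hooks
-- of the boxes (k , b₀) change.  The hook length of (k , b₀) is the content of the top box of
-- column k (in λ), resp. of the box above it (in λ ∪ ■), minus the content of ■; so it is
-- divisible by r exactly when that box has the colour of ■, and if that box is a corner, the
-- hook factor is the corner factor.  Walking along row b₀ these contributions telescope.  The
-- quadrant right of ■ and below row b₀ is the same argument for the transposed diagram, with q
-- and t exchanged.

open import Defs
open import Level using (Level; 0ℓ)
open import Data.Nat as ℕ using (ℕ; zero; suc; _∸_; _<_; _≤_; z≤n; s≤s; _<?_; NonZero; _%_; _/_)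
import Data.Nat.Properties as ℕP
open import Data.Nat.DivMod using (m<n⇒m%n≡m; m≡m%n+[m/n]*n; m%n<n; %-distribˡ-+; m*n%n≡0)
open import Data.Integer as ℤ using (ℤ; +_; -[1+_]; 0ℤ; 1ℤ; _%ℕ_; _/ℕ_; ∣_∣)
import Data.Integer.Properties as ℤP
open import Data.Integer.DivMod using (a≡a%ℕn+[a/ℕn]*n; n%ℕd<d)
open import Data.Integer.Tactic.RingSolver using (solve-∀; solve)
open import Data.Fin using (Fin; toℕ)
open import Data.Fin.Properties using (toℕ<n)
open import Data.List using (List; []; _∷_; length; filter; map; concatMap; upTo; applyUpTo; _++_)
import Data.List.Relation.Unary.Linked as Linked
import Data.List.Relation.Unary.All as All
open import Data.Product using (_×_; _,_; proj₁; proj₂)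
open import Data.Product.Properties using (≡-dec)
open import Data.Sum using (_⊎_; inj₁; inj₂)
import Data.Sum as Sum
open import Data.Empty using (⊥-elim)
open import Function using (_∘_; _⇔_; mk⇔; Equivalence)
import Function.Properties.Equivalence as ⇔
open import Relation.Nullary using (¬_; Dec; yes; no)
open import Relation.Nullary.Decidable using (_×-dec_; _⊎-dec_; ¬?)
open import Relation.Unary using (Pred; Decidable)
open import Relation.Binary.PropositionalEquality as ≡ using (_≡_; _≢_; cong; cong₂)
open import Algebra.Bundles using (CommutativeRing)

data Apart (h : ℕ) (d e : ℤ) : Set where
  up   : + h ≡ e ℤ.- d → Apart h d e
  down : + h ≡ d ℤ.- e → Apart h d e

content : Box → ℤ
content (a , b) = + b ℤ.- + a

apart-right : ∀ a b → Apart 1 (content (a , b)) (content (suc a , b))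
apart-right a b = down (one (+ a) (+ b))
  where
  one : ∀ A B → 1ℤ ≡ (B ℤ.- A) ℤ.- (B ℤ.- (1ℤ ℤ.+ A))
  one = solve-∀

apart-up : ∀ a b → Apart 1 (content (a , b)) (content (a , suc b))
apart-up a b = up (one (+ a) (+ b))
  where
  one : ∀ A B → 1ℤ ≡ ((1ℤ ℤ.+ B) ℤ.- A) ℤ.- (B ℤ.- A)
  one = solve-∀

-- Colours enter only through the class C of contents of colour i, so that transposition, which
-- negates contents, stays within the same notion.
IsResidueClass : (r : ℕ) .{{_ : NonZero r}} → (ℤ → Set) → Set
IsResidueClass r C = ∀ {d e h} → Apart h d e → C d → (C e ⇔ h % r ≡ 0)

module Residues (r : ℕ) .{{_ : NonZero r}} where

  private
    ∣w∣*r<r⇒w≡0 : ∀ w → ∣ w ∣ ℕ.* r < r → w ≡ 0ℤ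
    ∣w∣*r<r⇒w≡0 w lt with ∣ w ∣ in eq
    ... | zero  = ℤP.∣i∣≡0⇒i≡0 eq
    ... | suc n = ⊥-elim (ℕP.<-irrefl ≡.refl (ℕP.<-≤-trans lt (ℕP.m≤m+n r (n ℕ.* r))))

  %ℕ-unique : ∀ {x k} z → k < r → x ≡ + k ℤ.+ z ℤ.* + r → x %ℕ r ≡ k
  %ℕ-unique {x} {k} z k<r x≡ = ≡.sym (ℤP.+-injective k≡k′)
    where
    k′ : ℕ
    k′ = x %ℕ r
    z′ : ℤ
    z′ = x /ℕ r
    k-k′ : + k ℤ.- + k′ ≡ (z′ ℤ.- z) ℤ.* + r
    k-k′ = begin
      + k ℤ.- + k′
        ≡⟨ expand (+ k) (+ k′) z (+ r) ⟩
      ((+ k ℤ.+ z ℤ.* + r) ℤ.- z ℤ.* + r) ℤ.- + k′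
        ≡⟨ cong (λ w → (w ℤ.- z ℤ.* + r) ℤ.- + k′) (≡.trans (≡.sym x≡) (a≡a%ℕn+[a/ℕn]*n x r)) ⟩
      ((+ k′ ℤ.+ z′ ℤ.* + r) ℤ.- z ℤ.* + r) ℤ.- + k′
        ≡⟨ cancel (+ k′) z z′ (+ r) ⟩
      (z′ ℤ.- z) ℤ.* + r ∎
      where
      open ≡.≡-Reasoning
      expand : ∀ (k k′ z r : ℤ) → k ℤ.- k′ ≡ ((k ℤ.+ z ℤ.* r) ℤ.- z ℤ.* r) ℤ.- k′
      expand = solve-∀
      cancel : ∀ (k′ z z′ r : ℤ) → ((k′ ℤ.+ z′ ℤ.* r) ℤ.- z ℤ.* r) ℤ.- k′ ≡ (z′ ℤ.- z) ℤ.* r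
      cancel = solve-∀
    ∣k-k′∣<r : ∣ + k ℤ.- + k′ ∣ < r
    ∣k-k′∣<r = ℕP.≤-<-trans (ℕP.≤-reflexive (cong ∣_∣ (ℤP.m-n≡m⊖n k k′)))
                 (ℕP.≤-<-trans (ℤP.∣m⊝n∣≤m⊔n k k′) (ℕP.⊔-lub k<r (n%ℕd<d x r)))
    k≡k′ : + k ≡ + k′
    k≡k′ = ℤP.i-j≡0⇒i≡j (+ k) (+ k′) (≡.trans k-k′ (cong (ℤ._* + r) (∣w∣*r<r⇒w≡0 (z′ ℤ.- z)
             (≡.subst (_< r) (≡.trans (cong ∣_∣ k-k′) (ℤP.abs-* (z′ ℤ.- z) (+ r))) ∣k-k′∣<r))))

  +-%ℕ : ∀ x h → (x ℤ.+ + h) %ℕ r ≡ (x %ℕ r ℕ.+ h) % r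
  +-%ℕ x h = %ℕ-unique (+ v ℤ.+ z) (m%n<n (k ℕ.+ h) r) (begin
    x ℤ.+ + h                            ≡⟨ cong (ℤ._+ + h) (a≡a%ℕn+[a/ℕn]*n x r) ⟩
    (+ k ℤ.+ z ℤ.* + r) ℤ.+ + h          ≡⟨ regroup (+ k) (+ h) z (+ r) ⟩
    (+ k ℤ.+ + h) ℤ.+ z ℤ.* + r          ≡⟨ cong (ℤ._+ z ℤ.* + r) (≡.sym (ℤP.pos-+ k h)) ⟩
    + (k ℕ.+ h) ℤ.+ z ℤ.* + r            ≡⟨ cong (λ w → + w ℤ.+ z ℤ.* + r) (m≡m%n+[m/n]*n (k ℕ.+ h) r) ⟩
    + (u ℕ.+ v ℕ.* r) ℤ.+ z ℤ.* + r      ≡⟨ cong (ℤ._+ z ℤ.* + r) (≡.trans (ℤP.pos-+ u (v ℕ.* r))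
                                                                       (cong (λ w → + u ℤ.+ w) (ℤP.pos-* v r))) ⟩
    (+ u ℤ.+ + v ℤ.* + r) ℤ.+ z ℤ.* + r  ≡⟨ collect (+ u) (+ v) z (+ r) ⟩
    + u ℤ.+ (+ v ℤ.+ z) ℤ.* + r          ∎)
    where
    open ≡.≡-Reasoning
    k : ℕ
    k = x %ℕ r
    z : ℤ
    z = x /ℕ r
    u v : ℕ
    u = (k ℕ.+ h) % r
    v = (k ℕ.+ h) / r
    regroup : ∀ (k h z r : ℤ) → (k ℤ.+ z ℤ.* r) ℤ.+ h ≡ (k ℤ.+ h) ℤ.+ z ℤ.* r
    regroup = solve-∀
    collect : ∀ (u v z r : ℤ) → (u ℤ.+ v ℤ.* r) ℤ.+ z ℤ.* r ≡ u ℤ.+ (v ℤ.+ z) ℤ.* r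
    collect = solve-∀

  [k+h]%r≡k⇔h%r≡0 : ∀ {k} h → k < r → (k ℕ.+ h) % r ≡ k ⇔ h % r ≡ 0
  [k+h]%r≡k⇔h%r≡0 {k} h k<r = mk⇔ to from
    where
    to : (k ℕ.+ h) % r ≡ k → h % r ≡ 0
    to e = ≡.subst (λ m → m % r ≡ 0) (≡.sym h≡) (m*n%n≡0 ((k ℕ.+ h) / r) r)
      where
      h≡ : h ≡ (k ℕ.+ h) / r ℕ.* r
      h≡ = ℕP.+-cancelˡ-≡ k h _ (≡.trans (m≡m%n+[m/n]*n (k ℕ.+ h) r) (cong (ℕ._+ (k ℕ.+ h) / r ℕ.* r) e))
    from : h % r ≡ 0 → (k ℕ.+ h) % r ≡ k
    from e = begin
      (k ℕ.+ h) % r          ≡⟨ %-distribˡ-+ k h r ⟩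
      (k % r ℕ.+ h % r) % r  ≡⟨ cong₂ (λ m n → (m ℕ.+ n) % r) (m<n⇒m%n≡m k<r) e ⟩
      (k ℕ.+ 0) % r          ≡⟨ cong (_% r) (ℕP.+-identityʳ k) ⟩
      k % r                  ≡⟨ m<n⇒m%n≡m k<r ⟩
      k                      ∎
      where open ≡.≡-Reasoning

  %ℕ-shift : ∀ x h → (x ℤ.+ + h) %ℕ r ≡ x %ℕ r ⇔ h % r ≡ 0
  %ℕ-shift x h = ≡.subst (λ m → m ≡ x %ℕ r ⇔ h % r ≡ 0) (≡.sym (+-%ℕ x h))
                       ([k+h]%r≡k⇔h%r≡0 h (n%ℕd<d x r))

  private
    shifted-by : ∀ {d e h} → + h ≡ e ℤ.- d → e ≡ d ℤ.+ + h
    shifted-by {d} {e} h≡e-d = ≡.trans (e≡d+[e-d] d e) (cong (λ w → d ℤ.+ w) (≡.sym h≡e-d))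
      where
      e≡d+[e-d] : ∀ d e → e ≡ d ℤ.+ (e ℤ.- d)
      e≡d+[e-d] = solve-∀

  %ℕ-isResidueClass : ∀ {i} → i < r → IsResidueClass r (λ d → d %ℕ r ≡ i)
  %ℕ-isResidueClass _ {d} {e} {h} (up h≡e-d) ≡.refl =
    ≡.subst (λ x → x %ℕ r ≡ d %ℕ r ⇔ h % r ≡ 0) (≡.sym (shifted-by {d} {e} h≡e-d)) (%ℕ-shift d h)
  %ℕ-isResidueClass _ {d} {e} {h} (down h≡d-e) ≡.refl =
    ≡.subst (λ x → e %ℕ r ≡ x %ℕ r ⇔ h % r ≡ 0) (≡.sym (shifted-by {e} {d} h≡d-e))
          (⇔.trans (mk⇔ ≡.sym ≡.sym) (%ℕ-shift e h))

module _ {r : ℕ} .{{_ : NonZero r}} {C : ℤ → Set} (isClass : IsResidueClass r C) where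

  private
    neg-sub : ∀ d e → e ℤ.- d ≡ ℤ.- d ℤ.- ℤ.- e
    neg-sub = solve-∀

  IsResidueClass-neg : IsResidueClass r (C ∘ ℤ.-_)
  IsResidueClass-neg {d} {e} (up h≡e-d) = isClass (down (≡.trans h≡e-d (neg-sub d e)))
  IsResidueClass-neg {d} {e} (down h≡d-e) = isClass (up (≡.trans h≡d-e (neg-sub e d)))

  apart-by-one⇒¬same-class : 1 < r → ∀ {d e} → Apart 1 d e → C d → ¬ C e
  apart-by-one⇒¬same-class 1<r apart Cd Ce
    with ≡.trans (≡.sym (m<n⇒m%n≡m 1<r)) (Equivalence.to (isClass apart Cd) Ce)
  ... | ()

module RangeProducts {c ℓ : Level} (Rg : CommutativeRing c ℓ) where

  open CommutativeRing Rg
  open import Algebra.Properties.CommutativeSemigroup *-commutativeSemigroup using (interchange)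
  open import Relation.Binary.Reasoning.Setoid setoid

  ∏ : ℕ → (ℕ → Carrier) → Carrier
  ∏ zero    f = 1#
  ∏ (suc n) f = f 0 * ∏ n (f ∘ suc)

  ∏-cong : ∀ n {f g : ℕ → Carrier} → (∀ k → k < n → f k ≈ g k) → ∏ n f ≈ ∏ n g
  ∏-cong zero    f≈g = refl
  ∏-cong (suc n) f≈g = *-cong (f≈g 0 (s≤s z≤n)) (∏-cong n (λ k k<n → f≈g (suc k) (s≤s k<n)))

  ∏-≈1 : ∀ n {f : ℕ → Carrier} → (∀ k → k < n → f k ≈ 1#) → ∏ n f ≈ 1#
  ∏-≈1 zero    f≈1 = refl
  ∏-≈1 (suc n) f≈1 = trans (*-cong (f≈1 0 (s≤s z≤n)) (∏-≈1 n (λ k k<n → f≈1 (suc k) (s≤s k<n))))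
                           (*-identityˡ 1#)

  ∏-* : ∀ n (f g : ℕ → Carrier) → ∏ n (λ k → f k * g k) ≈ ∏ n f * ∏ n g
  ∏-* zero    f g = sym (*-identityˡ 1#)
  ∏-* (suc n) f g = trans (*-congˡ (∏-* n (f ∘ suc) (g ∘ suc))) (interchange _ _ _ _)

  ∏-*-* : ∀ n (f g h : ℕ → Carrier) → ∏ n (λ k → f k * (g k * h k)) ≈ ∏ n f * (∏ n g * ∏ n h)
  ∏-*-* n f g h = trans (∏-* n f _) (*-congˡ (∏-* n g h))

  ∏-+ : ∀ m n (f : ℕ → Carrier) → ∏ (m ℕ.+ n) f ≈ ∏ m f * ∏ n (λ k → f (m ℕ.+ k))
  ∏-+ zero    n f = sym (*-identityˡ _)
  ∏-+ (suc m) n f = trans (*-congˡ (∏-+ m n (f ∘ suc))) (sym (*-assoc _ _ _))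

  ∏-snoc : ∀ n (f : ℕ → Carrier) → ∏ (suc n) f ≈ ∏ n f * f n
  ∏-snoc zero    f = *-comm _ _
  ∏-snoc (suc n) f = trans (*-congˡ (∏-snoc n (f ∘ suc))) (sym (*-assoc _ _ _))

  ∏-single : ∀ n k (f : ℕ → Carrier) → k < n → (∀ j → j < n → j ≢ k → f j ≈ 1#) → ∏ n f ≈ f k
  ∏-single (suc n) zero f _ others≈1 =
    trans (*-congˡ (∏-≈1 n (λ j j<n → others≈1 (suc j) (s≤s j<n) (λ ())))) (*-identityʳ _)
  ∏-single (suc n) (suc k) f (s≤s k<n) others≈1 =
    trans (*-congʳ (others≈1 0 (s≤s z≤n) (λ ())))
          (trans (*-identityˡ _)
                 (∏-single n k (f ∘ suc) k<n (λ j j<n j≢k → others≈1 (suc j) (s≤s j<n) (j≢k ∘ ℕP.suc-injective))))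

  ∏-single-offset : ∀ n o j (f : ℕ → Carrier) → o ≤ j → j < o ℕ.+ n →
                    (∀ k → k < n → o ℕ.+ k ≢ j → f (o ℕ.+ k) ≈ 1#) → ∏ n (λ k → f (o ℕ.+ k)) ≈ f j
  ∏-single-offset n o j f o≤j j<o+n others≈1 =
    trans (∏-single n (j ∸ o) (λ k → f (o ℕ.+ k)) j-o<n
             (λ k k<n k≢j-o → others≈1 k k<n
                (λ o+k≡j → k≢j-o (ℕP.+-cancelˡ-≡ o k (j ∸ o) (≡.trans o+k≡j (≡.sym o+[j-o]≡j))))))
          (reflexive (cong f o+[j-o]≡j))
    where
    o+[j-o]≡j : o ℕ.+ (j ∸ o) ≡ j
    o+[j-o]≡j = ℕP.m+[n∸m]≡n o≤j
    j-o<n : j ∸ o < n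
    j-o<n = ℕP.+-cancelˡ-< o (j ∸ o) n (≡.subst (_< o ℕ.+ n) (≡.sym o+[j-o]≡j) j<o+n)

  ∏-truncate : ∀ m n (f : ℕ → Carrier) → m ≤ n → (∀ k → m ≤ k → k < n → f k ≈ 1#) → ∏ n f ≈ ∏ m f
  ∏-truncate zero    n       f _         tail≈1 = ∏-≈1 n (λ k → tail≈1 k z≤n)
  ∏-truncate (suc m) (suc n) f (s≤s m≤n) tail≈1 =
    *-congˡ (∏-truncate m n (f ∘ suc) m≤n (λ k m≤k k<n → tail≈1 (suc k) (s≤s m≤k) (s≤s k<n)))

  ∏-comm : ∀ m n (h : ℕ → ℕ → Carrier) → ∏ m (λ a → ∏ n (h a)) ≈ ∏ n (λ b → ∏ m (λ a → h a b))
  ∏-comm zero    n h = sym (∏-≈1 n (λ _ _ → refl))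
  ∏-comm (suc m) n h = trans (*-congˡ (∏-comm m n (h ∘ suc))) (sym (∏-* n (h 0) _))

  ∏-telescope : ∀ n (X R A Y : ℕ → Carrier) → X 0 ≈ A 0 →
                (∀ k → k < n → X (suc k) * R k ≈ A (suc k) * Y k) → R n ≈ Y n →
                ∏ (suc n) X * ∏ (suc n) R ≈ ∏ (suc n) A * ∏ (suc n) Y
  ∏-telescope n X R A Y X₀≈A₀ steps Rₙ≈Yₙ = begin
    ∏ (suc n) X * ∏ (suc n) R                         ≈⟨ regroup X R ⟩
    X 0 * (∏ n (λ k → X (suc k) * R k) * R n)          ≈⟨ *-cong X₀≈A₀ (*-cong (∏-cong n steps) Rₙ≈Yₙ) ⟩
    A 0 * (∏ n (λ k → A (suc k) * Y k) * Y n)          ≈⟨ regroup A Y ⟨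
    ∏ (suc n) A * ∏ (suc n) Y                         ∎
    where
    regroup : ∀ U V → ∏ (suc n) U * ∏ (suc n) V ≈ U 0 * (∏ n (λ k → U (suc k) * V k) * V n)
    regroup U V = begin
      (U 0 * ∏ n (U ∘ suc)) * ∏ (suc n) V        ≈⟨ *-congˡ (∏-snoc n V) ⟩
      (U 0 * ∏ n (U ∘ suc)) * (∏ n V * V n)       ≈⟨ *-assoc _ _ _ ⟩
      U 0 * (∏ n (U ∘ suc) * (∏ n V * V n))       ≈⟨ *-congˡ (*-assoc _ _ _) ⟨
      U 0 * ((∏ n (U ∘ suc) * ∏ n V) * V n)       ≈⟨ *-congˡ (*-congʳ (∏-* n (U ∘ suc) V)) ⟨
      U 0 * (∏ n (λ k → U (suc k) * V k) * V n)   ∎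

  ∏² : ℕ → ℕ → (ℕ × ℕ → Carrier) → Carrier
  ∏² m n h = ∏ n (λ b → ∏ m (λ a → h (a , b)))

  ∏²-cong : ∀ m n {f g : ℕ × ℕ → Carrier} →
            (∀ a b → a < m → b < n → f (a , b) ≈ g (a , b)) → ∏² m n f ≈ ∏² m n g
  ∏²-cong m n f≈g = ∏-cong n (λ b b<n → ∏-cong m (λ a a<m → f≈g a b a<m b<n))

  ∏²-* : ∀ m n (f g : ℕ × ℕ → Carrier) → ∏² m n (λ s → f s * g s) ≈ ∏² m n f * ∏² m n g
  ∏²-* m n f g = trans (∏-cong n (λ b _ → ∏-* m (λ a → f (a , b)) (λ a → g (a , b)))) (∏-* n _ _)

  ∏²-*³ : ∀ m n (f g h : ℕ × ℕ → Carrier) →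
          ∏² m n (λ s → f s * g s * h s) ≈ ∏² m n f * ∏² m n g * ∏² m n h
  ∏²-*³ m n f g h = trans (∏²-* m n (λ s → f s * g s) h) (*-congʳ (∏²-* m n f g))

  ∏²-by-columns : ∀ m n (h : ℕ × ℕ → Carrier) → ∏² m n h ≈ ∏ m (λ a → ∏ n (λ b → h (a , b)))
  ∏²-by-columns m n h = sym (∏-comm m n (λ a b → h (a , b)))

  ∏²-truncate : ∀ m n m′ n′ (f : ℕ × ℕ → Carrier) → m ≤ m′ → n ≤ n′ →
                (∀ a b → m ≤ a ⊎ n ≤ b → f (a , b) ≈ 1#) → ∏² m′ n′ f ≈ ∏² m n f
  ∏²-truncate m n m′ n′ f m≤m′ n≤n′ outside≈1 = trans
    (∏-truncate n n′ _ n≤n′ (λ b n≤b _ → ∏-≈1 m′ (λ a _ → outside≈1 a b (inj₂ n≤b))))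
    (∏-cong n (λ b _ → ∏-truncate m m′ _ m≤m′ (λ a m≤a _ → outside≈1 a b (inj₁ m≤a))))

  ∏²-quadrants : ∀ m m′ n n′ (h : ℕ × ℕ → Carrier) →
    ∏² (m ℕ.+ m′) (n ℕ.+ n′) h ≈
      (∏² m n h * ∏² m′ n (λ (a , b) → h (m ℕ.+ a , b)))
    * (∏² m n′ (λ (a , b) → h (a , n ℕ.+ b)) * ∏² m′ n′ (λ (a , b) → h (m ℕ.+ a , n ℕ.+ b)))
  ∏²-quadrants m m′ n n′ h = trans (∏-+ n n′ _)
    (*-cong (trans (∏-cong n (λ b _ → ∏-+ m m′ _)) (∏-* n _ _))
            (trans (∏-cong n′ (λ b _ → ∏-+ m m′ _)) (∏-* n′ _ _)))

  when : {P : Set} → Dec P → Carrier → Carrier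
  when (yes _) x = x
  when (no _)  _ = 1#

  when-yes : {P : Set} (p? : Dec P) → P → ∀ x → when p? x ≈ x
  when-yes (yes _) _ _ = refl
  when-yes (no ¬p) p _ = ⊥-elim (¬p p)

  when-no : {P : Set} (p? : Dec P) → ¬ P → ∀ x → when p? x ≈ 1#
  when-no (yes p) ¬p _ = ⊥-elim (¬p p)
  when-no (no _)  _  _ = refl

  when-cong : {P Q : Set} (p? : Dec P) (q? : Dec Q) → (P → Q) → (Q → P) →
              ∀ {x y} → x ≈ y → when p? x ≈ when q? y
  when-cong (yes _) (yes _) _   _   x≈y = x≈y
  when-cong (yes p) (no ¬q) p⇒q _   _   = ⊥-elim (¬q (p⇒q p))
  when-cong (no ¬p) (yes q) _   q⇒p _   = ⊥-elim (¬p (q⇒p q))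
  when-cong (no _)  (no _)  _   _   _   = refl

  when-merge : {P Q : Set} (p? : Dec P) (q? : Dec Q) → (P → Q) → (Q → P) →
               ∀ x y → when p? x * when q? y ≈ when q? (x * y)
  when-merge (yes _) (yes _) _   _   _ _ = refl
  when-merge (yes p) (no ¬q) p⇒q _   _ _ = ⊥-elim (¬q (p⇒q p))
  when-merge (no ¬p) (yes q) _   q⇒p _ _ = ⊥-elim (¬p (q⇒p q))
  when-merge (no _)  (no _)  _   _   _ _ = *-identityˡ 1#

+-∸ : ∀ {x y} → y ≤ x → + (x ∸ y) ≡ + x ℤ.- + y
+-∸ {x} {y} y≤x = ≡.sym (≡.trans (ℤP.m-n≡m⊖n x y) (ℤP.⊖-≥ y≤x))

+-gap : ∀ {x y} → y < x → + (x ∸ y ∸ 1) ≡ (+ x ℤ.- + y) ℤ.- 1ℤ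
+-gap {x} {y} y<x = ≡.trans (+-∸ (ℕP.m<n⇒0<n∸m y<x)) (cong (ℤ._- 1ℤ) (+-∸ (ℕP.<⇒≤ y<x)))

module Monomials {c ℓ : Level} (Rg : CommutativeRing c ℓ) (q q⁻¹ t t⁻¹ : CommutativeRing.Carrier Rg)
  (qq⁻¹≈1 : CommutativeRing._≈_ Rg (CommutativeRing._*_ Rg q q⁻¹) (CommutativeRing.1# Rg))
  (tt⁻¹≈1 : CommutativeRing._≈_ Rg (CommutativeRing._*_ Rg t t⁻¹) (CommutativeRing.1# Rg)) where

  open CommutativeRing Rg
  open Expr Rg q q⁻¹ t t⁻¹
  open import Algebra.Properties.CommutativeSemigroup *-commutativeSemigroup using (interchange)
  open import Relation.Binary.Reasoning.Setoid setoid

  hookFactor : ℕ → ℕ → Carrier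
  hookFactor α β = (1# - mono (+ suc α) (ℤ.- + β)) * (1# - mono (ℤ.- + α) (+ suc β))

  1-‿cong : ∀ {x y} → x ≈ y → 1# - x ≈ 1# - y
  1-‿cong x≈y = +-congˡ (-‿cong x≈y)

  private
    zpow : Carrier → Carrier → ℤ → Carrier
    zpow x x⁻¹ (+ k)    = x ^ k
    zpow x x⁻¹ -[1+ k ] = x⁻¹ ^ suc k

    mono-zpow : ∀ m n → mono m n ≡ zpow q q⁻¹ m * zpow t t⁻¹ n
    mono-zpow (+ _)    (+ _)    = ≡.refl
    mono-zpow (+ _)    -[1+ _ ] = ≡.refl
    mono-zpow -[1+ _ ] (+ _)    = ≡.refl
    mono-zpow -[1+ _ ] -[1+ _ ] = ≡.refl

    *-zpow : ∀ {x x⁻¹} → x * x⁻¹ ≈ 1# → ∀ m → x * zpow x x⁻¹ m ≈ zpow x x⁻¹ (1ℤ ℤ.+ m)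
    *-zpow xx⁻¹≈1 (+ _)           = refl
    *-zpow xx⁻¹≈1 -[1+ zero ]     = trans (*-congˡ (*-identityʳ _)) xx⁻¹≈1
    *-zpow xx⁻¹≈1 -[1+ suc _ ]    = trans (sym (*-assoc _ _ _)) (trans (*-congʳ xx⁻¹≈1) (*-identityˡ _))

  qt*mono : ∀ m n → q * t * mono m n ≈ mono (1ℤ ℤ.+ m) (1ℤ ℤ.+ n)
  qt*mono m n = begin
    q * t * mono m n                              ≡⟨ cong (q * t *_) (mono-zpow m n) ⟩
    q * t * (zpow q q⁻¹ m * zpow t t⁻¹ n)         ≈⟨ interchange q t _ _ ⟩
    (q * zpow q q⁻¹ m) * (t * zpow t t⁻¹ n)       ≈⟨ *-cong (*-zpow qq⁻¹≈1 m) (*-zpow tt⁻¹≈1 n) ⟩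
    zpow q q⁻¹ (1ℤ ℤ.+ m) * zpow t t⁻¹ (1ℤ ℤ.+ n) ≡⟨ mono-zpow (1ℤ ℤ.+ m) (1ℤ ℤ.+ n) ⟨
    mono (1ℤ ℤ.+ m) (1ℤ ℤ.+ n)                    ∎

  removable-corner-factor : ∀ {a₀ b₀ k c} → k < a₀ → b₀ < c →
    (1# - q * t * ratio (k , c ∸ 1) (a₀ , b₀)) * (1# - ratio (a₀ , b₀) (k , c ∸ 1))
      ≈ hookFactor (a₀ ∸ k ∸ 1) (c ∸ b₀ ∸ 1)
  removable-corner-factor {a₀} {b₀} {k} {c} k<a₀ b₀<c = begin
      (1# - q * t * ratio (k , c ∸ 1) (a₀ , b₀)) * (1# - ratio (a₀ , b₀) (k , c ∸ 1))
    ≈⟨ *-congʳ (1-‿cong (qt*mono (+ k ℤ.- + a₀) (+ (c ∸ 1) ℤ.- + b₀))) ⟩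
      (1# - mono (1ℤ ℤ.+ (+ k ℤ.- + a₀)) (1ℤ ℤ.+ (+ (c ∸ 1) ℤ.- + b₀)))
        * (1# - mono (+ a₀ ℤ.- + k) (+ b₀ ℤ.- + (c ∸ 1)))
    ≡⟨ exponents (+ a₀) (+ k) (+ c) (+ b₀) (+-gap k<a₀) (+-gap b₀<c) (+-∸ (ℕP.≤-trans (s≤s z≤n) b₀<c)) ⟩
      (1# - mono (ℤ.- + α) (+ suc β)) * (1# - mono (+ suc α) (ℤ.- + β))
    ≈⟨ *-comm _ _ ⟩
      hookFactor α β
    ∎
    where
    α β : ℕ
    α = a₀ ∸ k ∸ 1
    β = c ∸ b₀ ∸ 1
    exponents : ∀ A K C B {a b C′} → a ≡ (A ℤ.- K) ℤ.- 1ℤ → b ≡ (C ℤ.- B) ℤ.- 1ℤ → C′ ≡ C ℤ.- 1ℤ →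
      (1# - mono (1ℤ ℤ.+ (K ℤ.- A)) (1ℤ ℤ.+ (C′ ℤ.- B))) * (1# - mono (A ℤ.- K) (B ℤ.- C′))
        ≡ (1# - mono (ℤ.- a) (1ℤ ℤ.+ b)) * (1# - mono (1ℤ ℤ.+ a) (ℤ.- b))
    exponents A K C B ≡.refl ≡.refl ≡.refl = cong₂ (λ m n → (1# - m) * (1# - n))
      (cong₂ mono e₁ e₂) (cong₂ mono e₃ e₄)
      where
      e₁ : 1ℤ ℤ.+ (K ℤ.- A) ≡ ℤ.- ((A ℤ.- K) ℤ.- 1ℤ)
      e₁ = solve (A ∷ K ∷ [])
      e₂ : 1ℤ ℤ.+ ((C ℤ.- 1ℤ) ℤ.- B) ≡ 1ℤ ℤ.+ ((C ℤ.- B) ℤ.- 1ℤ)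
      e₂ = solve (C ∷ B ∷ [])
      e₃ : A ℤ.- K ≡ 1ℤ ℤ.+ ((A ℤ.- K) ℤ.- 1ℤ)
      e₃ = solve (A ∷ K ∷ [])
      e₄ : B ℤ.- (C ℤ.- 1ℤ) ≡ ℤ.- ((C ℤ.- B) ℤ.- 1ℤ)
      e₄ = solve (C ∷ B ∷ [])

  addable-corner-factor : ∀ {a₀ b₀ k c} → k < a₀ → b₀ < c →
    (1# - ratio (k , c) (a₀ , b₀)) * (1# - q * t * ratio (a₀ , b₀) (k , c))
      ≈ hookFactor (suc a₀ ∸ k ∸ 1) (c ∸ b₀ ∸ 1)
  addable-corner-factor {a₀} {b₀} {k} {c} k<a₀ b₀<c = begin
      (1# - ratio (k , c) (a₀ , b₀)) * (1# - q * t * ratio (a₀ , b₀) (k , c))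
    ≈⟨ *-congˡ (1-‿cong (qt*mono (+ a₀ ℤ.- + k) (+ b₀ ℤ.- + c))) ⟩
      (1# - mono (+ k ℤ.- + a₀) (+ c ℤ.- + b₀))
        * (1# - mono (1ℤ ℤ.+ (+ a₀ ℤ.- + k)) (1ℤ ℤ.+ (+ b₀ ℤ.- + c)))
    ≡⟨ exponents (+ a₀) (+ k) (+ c) (+ b₀) (+-gap (ℕP.m<n⇒m<1+n k<a₀)) (+-gap b₀<c) ⟩
      (1# - mono (ℤ.- + α) (+ suc β)) * (1# - mono (+ suc α) (ℤ.- + β))
    ≈⟨ *-comm _ _ ⟩
      hookFactor α β
    ∎
    where
    α β : ℕ
    α = suc a₀ ∸ k ∸ 1
    β = c ∸ b₀ ∸ 1
    exponents : ∀ A K C B {a b} → a ≡ ((1ℤ ℤ.+ A) ℤ.- K) ℤ.- 1ℤ → b ≡ (C ℤ.- B) ℤ.- 1ℤ →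
      (1# - mono (K ℤ.- A) (C ℤ.- B)) * (1# - mono (1ℤ ℤ.+ (A ℤ.- K)) (1ℤ ℤ.+ (B ℤ.- C)))
        ≡ (1# - mono (ℤ.- a) (1ℤ ℤ.+ b)) * (1# - mono (1ℤ ℤ.+ a) (ℤ.- b))
    exponents A K C B ≡.refl ≡.refl = cong₂ (λ m n → (1# - m) * (1# - n))
      (cong₂ mono e₁ e₂) (cong₂ mono e₃ e₄)
      where
      e₁ : K ℤ.- A ≡ ℤ.- (((1ℤ ℤ.+ A) ℤ.- K) ℤ.- 1ℤ)
      e₁ = solve (A ∷ K ∷ [])
      e₂ : C ℤ.- B ≡ 1ℤ ℤ.+ ((C ℤ.- B) ℤ.- 1ℤ)
      e₂ = solve (C ∷ B ∷ [])
      e₃ : 1ℤ ℤ.+ (A ℤ.- K) ≡ 1ℤ ℤ.+ (((1ℤ ℤ.+ A) ℤ.- K) ℤ.- 1ℤ)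
      e₃ = solve (A ∷ K ∷ [])
      e₄ : 1ℤ ℤ.+ (B ℤ.- C) ≡ ℤ.- ((C ℤ.- B) ℤ.- 1ℤ)
      e₄ = solve (C ∷ B ∷ [])

private
  suc-∸1 : ∀ {n} → 0 < n → suc (n ∸ 1) ≡ n
  suc-∸1 (s≤s _) = ≡.refl

  zero-or-pred<⇒≤ : ∀ {m n} → m ≡ 0 ⊎ m ∸ 1 < n → m ≤ n
  zero-or-pred<⇒≤ {zero}  _          = z≤n
  zero-or-pred<⇒≤ {suc _} (inj₂ m<n) = m<n

  ∸1< : ∀ {n} → 0 < n → n ∸ 1 < n
  ∸1< (s≤s _) = ℕP.n<1+n _

-- A Young diagram given by its row lengths ρ and column lengths κ (box (a , b) lies in column a
-- and row b); unlike a list of rows this description is symmetric, and transposing swaps ρ and κ.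
record Diagram : Set where
  field
    ρ κ : ℕ → ℕ
    ρ⇒κ : ∀ {a b} → a < ρ b → b < κ a
    κ⇒ρ : ∀ {a b} → b < κ a → a < ρ b

transpose : Diagram → Diagram
transpose D = record { ρ = κ ; κ = ρ ; ρ⇒κ = κ⇒ρ ; κ⇒ρ = ρ⇒κ }
  where open Diagram D

-- For ρ = row lam these are definitionally Removable and Addable.
IsRemovable : (ℕ → ℕ) → Box → Set
IsRemovable ρ (a , b) = a < ρ b × ¬ suc a < ρ b × ¬ a < ρ (suc b)

removable? : (ρ : ℕ → ℕ) (s : Box) → Dec (IsRemovable ρ s)
removable? ρ (a , b) = (a <? ρ b) ×-dec ¬? (suc a <? ρ b) ×-dec ¬? (a <? ρ (suc b))

IsAddable : (ℕ → ℕ) → Box → Set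
IsAddable ρ (a , b) = ¬ a < ρ b × (a ≡ 0 ⊎ a ∸ 1 < ρ b) × (b ≡ 0 ⊎ a < ρ (b ∸ 1))

addable? : (ρ : ℕ → ℕ) (s : Box) → Dec (IsAddable ρ s)
addable? ρ (a , b) = ¬? (a <? ρ b) ×-dec ((a ℕ.≟ 0) ⊎-dec (a ∸ 1 <? ρ b))
                                  ×-dec ((b ℕ.≟ 0) ⊎-dec (a <? ρ (b ∸ 1)))

module DiagramProperties (D : Diagram) where

  open Diagram D

  ρ-antitone : ∀ {b b′} → b ≤ b′ → ρ b′ ≤ ρ b
  ρ-antitone b≤b′ = ℕP.≮⇒≥ (λ ρb<ρb′ → ℕP.<-irrefl ≡.refl (κ⇒ρ (ℕP.≤-<-trans b≤b′ (ρ⇒κ ρb<ρb′))))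

  κ-antitone : ∀ {a a′} → a ≤ a′ → κ a′ ≤ κ a
  κ-antitone a≤a′ = ℕP.≮⇒≥ (λ κa<κa′ → ℕP.<-irrefl ≡.refl (ρ⇒κ (ℕP.≤-<-trans a≤a′ (κ⇒ρ κa<κa′))))

  removable⇒top : ∀ {a b} → IsRemovable ρ (a , b) → b ≡ κ a ∸ 1
  removable⇒top (a<ρb , _ , a≮ρ[1+b]) =
    ≡.sym (cong (_∸ 1) (ℕP.≤-antisym (ℕP.≮⇒≥ (a≮ρ[1+b] ∘ κ⇒ρ)) (ρ⇒κ a<ρb)))

  addable⇒above : ∀ {a b} → IsAddable ρ (a , b) → b ≡ κ a
  addable⇒above (a≮ρb , _ , below) =
    ℕP.≤-antisym (zero-or-pred<⇒≤ (Sum.map₂ ρ⇒κ below)) (ℕP.≮⇒≥ (a≮ρb ∘ κ⇒ρ))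

  top-removable : ∀ {a} → κ (suc a) < κ a → IsRemovable ρ (a , κ a ∸ 1)
  top-removable {a} κ[1+a]<κa =
      κ⇒ρ (∸1< 0<κa)
    , (λ 1+a<ρ → ℕP.<-irrefl ≡.refl (ℕP.<-≤-trans (ρ⇒κ 1+a<ρ) (ℕP.<⇒≤pred κ[1+a]<κa)))
    , (λ a<ρ → ℕP.<-irrefl ≡.refl (≡.subst (_< κ a) (suc-∸1 0<κa) (ρ⇒κ a<ρ)))
    where
    0<κa : 0 < κ a
    0<κa = ℕP.≤-<-trans z≤n κ[1+a]<κa

  top-¬removable : ∀ {a} → 0 < κ a → κ (suc a) ≡ κ a → ¬ IsRemovable ρ (a , κ a ∸ 1)
  top-¬removable {a} 0<κa κ[1+a]≡κa (_ , 1+a≮ρ , _) =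
    1+a≮ρ (κ⇒ρ (≡.subst (κ a ∸ 1 <_) (≡.sym κ[1+a]≡κa) (∸1< 0<κa)))

  above-addable : ∀ {a} → a ≡ 0 ⊎ κ a < κ (a ∸ 1) → 0 < κ a → IsAddable ρ (a , κ a)
  above-addable {a} left-end 0<κa =
      (λ a<ρ → ℕP.<-irrefl ≡.refl (ρ⇒κ a<ρ))
    , Sum.map₂ κ⇒ρ left-end
    , inj₂ (κ⇒ρ (∸1< 0<κa))

  above-¬addable : ∀ {a} → κ (suc a) ≡ κ a → ¬ IsAddable ρ (suc a , κ (suc a))
  above-¬addable {a} κ[1+a]≡κa (_ , inj₂ a<ρ , _) =
    ℕP.<-irrefl ≡.refl (≡.subst (_< κ a) κ[1+a]≡κa (ρ⇒κ a<ρ))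

  transpose-removable : ∀ a b → IsRemovable κ (b , a) ⇔ IsRemovable ρ (a , b)
  transpose-removable a b = mk⇔
    (λ (b<κa , 1+b≮κa , b≮κ[1+a]) → κ⇒ρ b<κa , b≮κ[1+a] ∘ ρ⇒κ , 1+b≮κa ∘ ρ⇒κ)
    (λ (a<ρb , 1+a≮ρb , a≮ρ[1+b]) → ρ⇒κ a<ρb , a≮ρ[1+b] ∘ κ⇒ρ , 1+a≮ρb ∘ κ⇒ρ)

  transpose-addable : ∀ a b → IsAddable κ (b , a) ⇔ IsAddable ρ (a , b)
  transpose-addable a b = mk⇔
    (λ (b≮κa , left , below) → b≮κa ∘ ρ⇒κ , Sum.map₂ κ⇒ρ below , Sum.map₂ κ⇒ρ left)
    (λ (a≮ρb , left , below) → a≮ρb ∘ κ⇒ρ , Sum.map₂ ρ⇒κ below , Sum.map₂ ρ⇒κ left)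

IsPartition-tail : ∀ {x xs} → IsPartition (x ∷ xs) → IsPartition xs
IsPartition-tail (dec , pos) = Linked.tail dec , All.tail pos

row-≤-head : ∀ {x xs} → IsPartition (x ∷ xs) → ∀ b → row xs b ≤ x
row-≤-head {xs = []}    _ _       = z≤n
row-≤-head {xs = _ ∷ _} p zero    = Linked.head (proj₁ p)
row-≤-head {xs = _ ∷ _} p (suc b) = ℕP.≤-trans (row-≤-head (IsPartition-tail p) b) (Linked.head (proj₁ p))

row⇒col : ∀ lam → IsPartition lam → ∀ {a b} → a < row lam b → b < col lam a
row⇒col (x ∷ xs) p {a} {b} a<row with a <? x
row⇒col (x ∷ xs) p {b = zero}  a<row | yes _ = s≤s z≤n
row⇒col (x ∷ xs) p {b = suc b} a<row | yes _ = s≤s (row⇒col xs (IsPartition-tail p) a<row)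
row⇒col (x ∷ xs) p {b = zero}  a<row | no a≮x = ⊥-elim (a≮x a<row)
row⇒col (x ∷ xs) p {b = suc b} a<row | no a≮x = ⊥-elim (a≮x (ℕP.<-≤-trans a<row (row-≤-head p b)))

col⇒row : ∀ lam → IsPartition lam → ∀ {a b} → b < col lam a → a < row lam b
col⇒row (x ∷ xs) p {a} {b} b<col with a <? x
col⇒row (x ∷ xs) p {b = zero}  b<col       | yes a<x = a<x
col⇒row (x ∷ xs) p {b = suc b} (s≤s b<col) | yes _   = col⇒row xs (IsPartition-tail p) b<col
col⇒row (x ∷ xs) p {b = b}     b<col       | no a≮x  =
  ⊥-elim (a≮x (ℕP.<-≤-trans (col⇒row xs (IsPartition-tail p) b<col) (row-≤-head p b)))

partitionDiagram : ∀ lam → IsPartition lam → Diagram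
partitionDiagram lam p = record
  { ρ = row lam ; κ = col lam ; ρ⇒κ = row⇒col lam p ; κ⇒ρ = col⇒row lam p }

row-beyond-length : ∀ lam {b} → length lam ≤ b → row lam b ≡ 0
row-beyond-length []       _         = ≡.refl
row-beyond-length (x ∷ xs) (s≤s len≤b) = row-beyond-length xs len≤b

col≤length : ∀ lam a → col lam a ≤ length lam
col≤length []       a = z≤n
col≤length (x ∷ xs) a with a <? x
... | yes _ = s≤s (col≤length xs a)
... | no  _ = ℕP.m≤n⇒m≤1+n (col≤length xs a)

length-addBox : ∀ lam a b → length lam ≤ length (addBox lam (a , b))
length-addBox []       a b       = z≤n
length-addBox (x ∷ xs) a zero    = ℕP.≤-refl
length-addBox (x ∷ xs) a (suc b) = s≤s (length-addBox xs a b)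

row₀-addBox : ∀ lam a b → row lam 0 ≤ row (addBox lam (a , b)) 0
row₀-addBox []       a b       = z≤n
row₀-addBox (x ∷ xs) a zero    = ℕP.n≤1+n x
row₀-addBox (x ∷ xs) a (suc b) = ℕP.≤-refl

row-addBox : ∀ lam a b → row (addBox lam (a , b)) b ≡ suc (row lam b)
row-addBox []       a zero    = ≡.refl
row-addBox []       a (suc b) = row-addBox [] a b
row-addBox (x ∷ xs) a zero    = ≡.refl
row-addBox (x ∷ xs) a (suc b) = row-addBox xs a b

row-addBox-other : ∀ lam a b {b′} → b′ ≢ b → row (addBox lam (a , b)) b′ ≡ row lam b′
row-addBox-other []       a zero    {zero}   b′≢b = ⊥-elim (b′≢b ≡.refl)
row-addBox-other []       a zero    {suc _}  _    = ≡.refl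
row-addBox-other []       a (suc b) {zero}   _    = ≡.refl
row-addBox-other []       a (suc b) {suc b′} b′≢b = row-addBox-other [] a b (b′≢b ∘ cong suc)
row-addBox-other (x ∷ xs) a zero    {zero}   b′≢b = ⊥-elim (b′≢b ≡.refl)
row-addBox-other (x ∷ xs) a zero    {suc _}  _    = ≡.refl
row-addBox-other (x ∷ xs) a (suc b) {zero}   _    = ≡.refl
row-addBox-other (x ∷ xs) a (suc b) {suc b′} b′≢b = row-addBox-other xs a b (b′≢b ∘ cong suc)

col-addBox : ∀ lam a b → col (addBox lam (a , b)) (row lam b) ≡ suc (col lam (row lam b))
col-addBox []       a zero    = ≡.refl
col-addBox []       a (suc b) = col-addBox [] a b
col-addBox (x ∷ xs) a zero with x <? suc x | x <? x
... | yes _   | no _    = ≡.refl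
... | no x≮1+x | _      = ⊥-elim (x≮1+x (ℕP.n<1+n x))
... | _       | yes x<x = ⊥-elim (ℕP.<-irrefl ≡.refl x<x)
col-addBox (x ∷ xs) a (suc b) with row xs b <? x
... | yes _ = cong suc (col-addBox xs a b)
... | no  _ = col-addBox xs a b

col-addBox-other : ∀ lam a b {c} → c ≢ row lam b → col (addBox lam (a , b)) c ≡ col lam c
col-addBox-other []       a zero    {c} c≢ with c <? 1
... | yes c<1 = ⊥-elim (c≢ (ℕP.n≤0⇒n≡0 (ℕP.≤-pred c<1)))
... | no  _   = ≡.refl
col-addBox-other []       a (suc b) {c} c≢ with c <? 0
... | no _ = col-addBox-other [] a b c≢
col-addBox-other (x ∷ xs) a zero    {c} c≢ with c <? suc x | c <? x
... | yes _     | yes _   = ≡.refl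
... | no  _     | no  _   = ≡.refl
... | yes c<1+x | no c≮x  = ⊥-elim (c≮x (ℕP.≤∧≢⇒< (ℕP.≤-pred c<1+x) c≢))
... | no c≮1+x  | yes c<x = ⊥-elim (c≮1+x (ℕP.m≤n⇒m≤1+n c<x))
col-addBox-other (x ∷ xs) a (suc b) {c} c≢ with c <? x
... | yes _ = cong suc (col-addBox-other xs a b c≢)
... | no  _ = col-addBox-other xs a b c≢

-- ρ⁺ and κ⁺ are the row and column lengths of D with the addable box ■ = (a₀ , b₀) added.
record CornerAddition : Set where
  field
    D : Diagram
    ρ⁺ κ⁺ : ℕ → ℕ
    a₀ b₀ : ℕ
    ρ-b₀ : Diagram.ρ D b₀ ≡ a₀
    κ-a₀ : Diagram.κ D a₀ ≡ b₀
    ρ⁺-b₀ : ρ⁺ b₀ ≡ suc a₀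
    κ⁺-a₀ : κ⁺ a₀ ≡ suc b₀
    ρ⁺-other : ∀ {b} → b ≢ b₀ → ρ⁺ b ≡ Diagram.ρ D b
    κ⁺-other : ∀ {a} → a ≢ a₀ → κ⁺ a ≡ Diagram.κ D a

  ■ : Box
  ■ = a₀ , b₀

transposeCorner : CornerAddition → CornerAddition
transposeCorner K = record
  { D = transpose D ; ρ⁺ = κ⁺ ; κ⁺ = ρ⁺ ; a₀ = b₀ ; b₀ = a₀
  ; ρ-b₀ = κ-a₀ ; κ-a₀ = ρ-b₀ ; ρ⁺-b₀ = κ⁺-a₀ ; κ⁺-a₀ = ρ⁺-b₀
  ; ρ⁺-other = κ⁺-other ; κ⁺-other = ρ⁺-other }
  where open CornerAddition K

module CornerAdditionProperties (K : CornerAddition) where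

  open CornerAddition K
  open Diagram D
  open DiagramProperties D

  ρ⁺⇒κ⁺ : ∀ {a b} → a < ρ⁺ b → b < κ⁺ a
  ρ⁺⇒κ⁺ {a} {b} a<ρ⁺b with b ℕ.≟ b₀ | a ℕ.≟ a₀
  ... | yes ≡.refl | yes ≡.refl rewrite κ⁺-a₀ = ℕP.n<1+n b₀
  ... | yes ≡.refl | no a≢a₀ rewrite κ⁺-other a≢a₀ | ρ⁺-b₀ =
    ρ⇒κ (≡.subst (a <_) (≡.sym ρ-b₀) (ℕP.≤∧≢⇒< (ℕP.≤-pred a<ρ⁺b) a≢a₀))
  ... | no b≢b₀  | yes ≡.refl rewrite κ⁺-a₀ | ρ⁺-other b≢b₀ =
    ℕP.m≤n⇒m≤1+n (≡.subst (b <_) κ-a₀ (ρ⇒κ a<ρ⁺b))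
  ... | no b≢b₀  | no a≢a₀ rewrite κ⁺-other a≢a₀ | ρ⁺-other b≢b₀ = ρ⇒κ a<ρ⁺b

  κ⁺⇒ρ⁺ : ∀ {a b} → b < κ⁺ a → a < ρ⁺ b
  κ⁺⇒ρ⁺ {a} {b} b<κ⁺a with b ℕ.≟ b₀ | a ℕ.≟ a₀
  ... | yes ≡.refl | yes ≡.refl rewrite ρ⁺-b₀ = ℕP.n<1+n a₀
  ... | yes ≡.refl | no a≢a₀ rewrite κ⁺-other a≢a₀ | ρ⁺-b₀ =
    ℕP.m≤n⇒m≤1+n (≡.subst (a <_) ρ-b₀ (κ⇒ρ b<κ⁺a))
  ... | no b≢b₀  | yes ≡.refl rewrite κ⁺-a₀ | ρ⁺-other b≢b₀ =
    κ⇒ρ (≡.subst (b <_) (≡.sym κ-a₀) (ℕP.≤∧≢⇒< (ℕP.≤-pred b<κ⁺a) b≢b₀))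
  ... | no b≢b₀  | no a≢a₀ rewrite κ⁺-other a≢a₀ | ρ⁺-other b≢b₀ = κ⇒ρ b<κ⁺a

  D⁺ : Diagram
  D⁺ = record { ρ = ρ⁺ ; κ = κ⁺ ; ρ⇒κ = ρ⁺⇒κ⁺ ; κ⇒ρ = κ⁺⇒ρ⁺ }

  b₀<κ : ∀ {a} → a < a₀ → b₀ < κ a
  b₀<κ a<a₀ = ρ⇒κ (≡.subst (_ <_) (≡.sym ρ-b₀) a<a₀)

  a₀<ρ : ∀ {b} → b < b₀ → a₀ < ρ b
  a₀<ρ b<b₀ = κ⇒ρ (≡.subst (_ <_) (≡.sym κ-a₀) b<b₀)

  ρ≤a₀ : ∀ {b} → b₀ ≤ b → ρ b ≤ a₀
  ρ≤a₀ b₀≤b = ℕP.≤-trans (ρ-antitone b₀≤b) (ℕP.≤-reflexive ρ-b₀)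

  ∉-upper-right : ∀ {a b} → a₀ ≤ a → b₀ ≤ b → ¬ a < ρ b
  ∉-upper-right a₀≤a b₀≤b a<ρb = ℕP.<-irrefl ≡.refl (ℕP.<-≤-trans a<ρb (ℕP.≤-trans (ρ≤a₀ b₀≤b) a₀≤a))

  ∉⁺-upper-right : ∀ {a b} → a₀ ≤ a → b₀ ≤ b → (a , b) ≢ ■ → ¬ a < ρ⁺ b
  ∉⁺-upper-right {a} {b} a₀≤a b₀≤b s≢■ a<ρ⁺b with b ℕ.≟ b₀
  ... | yes ≡.refl = s≢■ (cong (_, b₀) (ℕP.≤-antisym (ℕP.≤-pred (≡.subst (a <_) ρ⁺-b₀ a<ρ⁺b)) a₀≤a))
  ... | no b≢b₀  = ∉-upper-right a₀≤a b₀≤b (≡.subst (a <_) (ρ⁺-other b≢b₀) a<ρ⁺b)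

  ¬addable-upper-right : ∀ {a b} → a₀ ≤ a → b₀ ≤ b → (a , b) ≢ ■ → ¬ IsAddable ρ (a , b)
  ¬addable-upper-right {a} {b} a₀≤a b₀≤b s≢■ (_ , left , below) with b ℕ.≟ b₀
  ... | yes ≡.refl =
    s≢■ (cong (_, b₀) (ℕP.≤-antisym (zero-or-pred<⇒≤ (Sum.map₂ (≡.subst (a ∸ 1 <_) ρ-b₀) left)) a₀≤a))
  ... | no b≢b₀ with below
  ...   | inj₁ ≡.refl = b≢b₀ (≡.sym (ℕP.n≤0⇒n≡0 b₀≤b))
  ...   | inj₂ a<ρ[b-1] =
    ∉-upper-right a₀≤a (ℕP.<⇒≤pred (ℕP.≤∧≢⇒< b₀≤b (b≢b₀ ∘ ≡.sym))) a<ρ[b-1]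

  ■-removable⁺ : IsRemovable ρ⁺ ■
  ■-removable⁺ = ≡.subst (a₀ <_) (≡.sym ρ⁺-b₀) (ℕP.n<1+n a₀)
               , (λ 1+a₀<ρ⁺ → ℕP.<-irrefl ≡.refl (≡.subst (suc a₀ <_) ρ⁺-b₀ 1+a₀<ρ⁺))
               , ∉⁺-upper-right ℕP.≤-refl (ℕP.n≤1+n b₀) (λ ())

  ■-addable : IsAddable ρ ■
  ■-addable = ∉-upper-right ℕP.≤-refl ℕP.≤-refl
            , zero-or-pred {λ a → a < ρ b₀} a₀ (≡.subst (_ <_) (≡.sym ρ-b₀))
            , zero-or-pred {λ b → a₀ < ρ b} b₀ a₀<ρ
    where
    zero-or-pred : ∀ {P : ℕ → Set} n → (n ∸ 1 < n → P (n ∸ 1)) → n ≡ 0 ⊎ P (n ∸ 1)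
    zero-or-pred zero    _ = inj₁ ≡.refl
    zero-or-pred (suc n) p = inj₂ (p (ℕP.n<1+n n))

  module Colored {r : ℕ} .{{_ : NonZero r}} (1<r : 1 < r)
                 {C : ℤ → Set} (isClass : IsResidueClass r C) (C■ : C (content ■)) where

    private
      ¬C-neighbour : ∀ {d} → Apart 1 (content ■) d → ¬ C d
      ¬C-neighbour apart = apart-by-one⇒¬same-class isClass 1<r apart C■

      ¬C-neighbour′ : ∀ {d} → Apart 1 d (content ■) → ¬ C d
      ¬C-neighbour′ apart Cd = apart-by-one⇒¬same-class isClass 1<r apart Cd C■

    removable⁺⇔removable : ∀ {a b} → (a , b) ≢ ■ → C (content (a , b)) →
                           IsRemovable ρ⁺ (a , b) ⇔ IsRemovable ρ (a , b)
    removable⁺⇔removable {a} {b} s≢■ Cs with b ℕ.≟ b₀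
    ... | yes ≡.refl = mk⇔ (⊥-elim ∘ ¬removable⁺) (⊥-elim ∘ ¬removable)
      where
      ¬removable⁺ : ¬ IsRemovable ρ⁺ (a , b₀)
      ¬removable⁺ (a<ρ⁺ , 1+a≮ρ⁺ , _) rewrite ρ⁺-b₀ =
        s≢■ (cong (_, b₀) (ℕP.≤-antisym (ℕP.≤-pred a<ρ⁺) (ℕP.≮⇒≥ (1+a≮ρ⁺ ∘ s≤s))))
      ¬removable : ¬ IsRemovable ρ (a , b₀)
      ¬removable (a<ρ , 1+a≮ρ , _) rewrite ρ-b₀ with ℕP.≤-antisym a<ρ (ℕP.≮⇒≥ 1+a≮ρ)
      ... | ≡.refl = ¬C-neighbour′ (apart-right a b₀) Cs
    ... | no b≢b₀ with suc b ℕ.≟ b₀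
    ...   | no 1+b≢b₀ rewrite ρ⁺-other b≢b₀ | ρ⁺-other 1+b≢b₀ = ⇔.refl
    ...   | yes ≡.refl rewrite ρ⁺-other b≢b₀ | ρ⁺-b₀ | ρ-b₀ with a ℕ.≟ a₀
    ...     | yes ≡.refl = ⊥-elim (¬C-neighbour′ (apart-up a₀ b) Cs)
    ...     | no a≢a₀ = mk⇔ (λ (a<ρ , 1+a≮ρ , a≮1+a₀) → a<ρ , 1+a≮ρ , a≮1+a₀ ∘ ℕP.m<n⇒m<1+n)
                           (λ (a<ρ , 1+a≮ρ , a≮a₀) → a<ρ , 1+a≮ρ ,
                              λ a<1+a₀ → a≮a₀ (ℕP.≤∧≢⇒< (ℕP.≤-pred a<1+a₀) a≢a₀))

    private
      ¬addable⁺-row : ∀ {a} → C (content (a , b₀)) → ¬ IsAddable ρ⁺ (a , b₀)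
      ¬addable⁺-row {a} Cs (a≮ρ⁺ , left , _) rewrite ρ⁺-b₀ with a | ℕP.≮⇒≥ a≮ρ⁺ | left | Cs
      ... | suc a′ | s≤s a₀≤a′ | inj₂ a′<1+a₀ | Cs′ with ℕP.≤-antisym (ℕP.≤-pred a′<1+a₀) a₀≤a′
      ...   | ≡.refl = ¬C-neighbour (apart-right a₀ b₀) Cs′

      ¬addable-row : ∀ {a} → (a , b₀) ≢ ■ → ¬ IsAddable ρ (a , b₀)
      ¬addable-row s≢■ (a≮ρ , left , _) rewrite ρ-b₀ =
        s≢■ (cong (_, b₀) (ℕP.≤-antisym (zero-or-pred<⇒≤ left) (ℕP.≮⇒≥ a≮ρ)))

    addable⁺⇔addable : ∀ {a b} → (a , b) ≢ ■ → C (content (a , b)) →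
                       IsAddable ρ⁺ (a , b) ⇔ IsAddable ρ (a , b)
    addable⁺⇔addable {a} {b} s≢■ Cs with b ℕ.≟ b₀
    ... | yes ≡.refl = mk⇔ (⊥-elim ∘ ¬addable⁺-row Cs) (⊥-elim ∘ ¬addable-row s≢■)
    ... | no b≢b₀ with b ∸ 1 ℕ.≟ b₀
    ...   | no b-1≢b₀ rewrite ρ⁺-other b≢b₀ | ρ⁺-other b-1≢b₀ = ⇔.refl
    ...   | yes b-1≡b₀ with b | b-1≡b₀
    ...     | zero   | 0≡b₀ = ⊥-elim (b≢b₀ 0≡b₀)
    ...     | suc b′ | ≡.refl rewrite ρ⁺-other b≢b₀ | ρ⁺-b₀ | ρ-b₀ with a ℕ.≟ a₀
    ...       | yes ≡.refl = ⊥-elim (¬C-neighbour (apart-up a₀ b₀) Cs)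
    ...       | no a≢a₀ = mk⇔
      (λ (a≮ρ , left , below) → a≮ρ , left ,
         Sum.map (λ ()) (λ a<1+a₀ → ℕP.≤∧≢⇒< (ℕP.≤-pred a<1+a₀) a≢a₀) below)
      (λ (a≮ρ , left , below) → a≮ρ , left , Sum.map (λ ()) ℕP.m<n⇒m<1+n below)

partitionCorner : ∀ lam → IsPartition lam → ∀ {a₀ b₀} → Addable lam (a₀ , b₀) → CornerAddition
partitionCorner lam p {a₀} {b₀} (a₀∉ , left , below) = record
  { D = partitionDiagram lam p
  ; ρ⁺ = row lam⁺ ; κ⁺ = col lam⁺ ; a₀ = a₀ ; b₀ = b₀
  ; ρ-b₀ = row≡
  ; κ-a₀ = col≡
  ; ρ⁺-b₀ = ≡.trans (row-addBox lam a₀ b₀) (cong suc row≡)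
  ; κ⁺-a₀ = ≡.subst (λ a → col lam⁺ a ≡ suc b₀) row≡
      (≡.trans (col-addBox lam a₀ b₀) (cong suc (≡.trans (cong (col lam) row≡) col≡)))
  ; ρ⁺-other = row-addBox-other lam a₀ b₀
  ; κ⁺-other = λ a≢a₀ → col-addBox-other lam a₀ b₀ (a≢a₀ ∘ (λ e → ≡.trans e row≡))
  }
  where
  lam⁺ : List ℕ
  lam⁺ = addBox lam (a₀ , b₀)
  row≡ : row lam b₀ ≡ a₀
  row≡ = ℕP.≤-antisym (ℕP.≮⇒≥ a₀∉) (zero-or-pred<⇒≤ left)
  col≡ : col lam a₀ ≡ b₀
  col≡ = ℕP.≤-antisym (ℕP.≮⇒≥ (a₀∉ ∘ col⇒row lam p)) (zero-or-pred<⇒≤ (Sum.map₂ (row⇒col lam p) below))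

hookLength : ℕ → ℕ → ℕ → ℕ → ℕ
hookLength ρb κa a b = ρb ∸ a ∸ 1 ℕ.+ (κa ∸ b ∸ 1) ℕ.+ 1

-- The hook of (a , b) runs from the top box of column a to the box just left of (ρb , b).
hookLength-content : ∀ {ρb κa a b} → a < ρb → b < κa →
                     + hookLength ρb κa a b ≡ content (a , κa ∸ 1) ℤ.- content (ρb , b)
hookLength-content {ρb} {κa} {a} {b} a<ρb b<κa =
  linear (+ ρb) (+ κa) (+ a) (+ b) (+-gap a<ρb) (+-gap b<κa) (+-∸ (ℕP.≤-trans (s≤s z≤n) b<κa))
  where
  linear : ∀ P K A B {x y z} → x ≡ (P ℤ.- A) ℤ.- 1ℤ → y ≡ (K ℤ.- B) ℤ.- 1ℤ → z ≡ K ℤ.- 1ℤ →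
           (x ℤ.+ y) ℤ.+ 1ℤ ≡ (z ℤ.- A) ℤ.- (B ℤ.- P)
  linear P K A B ≡.refl ≡.refl ≡.refl = solve (P ∷ K ∷ A ∷ B ∷ [])

hookLength-content⁺ : ∀ {ρb κa a b} → a < suc ρb → b < κa →
                      + hookLength (suc ρb) κa a b ≡ content (a , κa) ℤ.- content (ρb , b)
hookLength-content⁺ {ρb} {κa} {a} {b} a<1+ρb b<κa =
  linear (+ ρb) (+ κa) (+ a) (+ b) (+-gap a<1+ρb) (+-gap b<κa)
  where
  linear : ∀ P K A B {x y} → x ≡ ((1ℤ ℤ.+ P) ℤ.- A) ℤ.- 1ℤ → y ≡ (K ℤ.- B) ℤ.- 1ℤ →
           (x ℤ.+ y) ℤ.+ 1ℤ ≡ (K ℤ.- A) ℤ.- (B ℤ.- P)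
  linear P K A B ≡.refl ≡.refl = solve (P ∷ K ∷ A ∷ B ∷ [])

module Quadrants {c ℓ : Level} (Rg : CommutativeRing c ℓ) (q q⁻¹ t t⁻¹ : CommutativeRing.Carrier Rg)
  (qq⁻¹≈1 : CommutativeRing._≈_ Rg (CommutativeRing._*_ Rg q q⁻¹) (CommutativeRing.1# Rg))
  (tt⁻¹≈1 : CommutativeRing._≈_ Rg (CommutativeRing._*_ Rg t t⁻¹) (CommutativeRing.1# Rg))
  (r : ℕ) .{{_ : NonZero r}} (1<r : 1 < r)
  {C : ℤ → Set} (C? : Decidable C) (isClass : IsResidueClass r C)
  (K : CornerAddition) (C■ : C (content (CornerAddition.■ K))) where

  open CommutativeRing Rg
  open Expr Rg q q⁻¹ t t⁻¹ using (ratio)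
  open RangeProducts Rg
  open Monomials Rg q q⁻¹ t t⁻¹ qq⁻¹≈1 tt⁻¹≈1
  open CornerAddition K
  open CornerAdditionProperties K
  open Colored 1<r isClass C■
  open Diagram D
  open DiagramProperties D
  open Equivalence
  open import Algebra.Properties.CommutativeSemigroup *-commutativeSemigroup using (xy∙z≈y∙xz; xy∙z≈y∙zx)
  open import Relation.Binary.Reasoning.Setoid setoid

  hookWeight : ℕ → ℕ → ℕ → ℕ → Carrier
  hookWeight ρb κa a b = when (a <? ρb) (when (hookLength ρb κa a b % r ℕ.≟ 0)
                                              (hookFactor (ρb ∸ a ∸ 1) (κa ∸ b ∸ 1)))

  nFactor : Diagram → Box → Carrier
  nFactor E (a , b) = hookWeight (Diagram.ρ E b) (Diagram.κ E a) a b

  colored? : (s : Box) → Dec (C (content s))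
  colored? s = C? (content s)

  R⁺-factor R-factor A⁺-factor A-factor lhs rhs : Box → Carrier
  R⁺-factor s = when (removable? ρ⁺ s ×-dec colored? s) (1# - q * t * ratio s ■)
  R-factor  s = when (removable? ρ  s ×-dec colored? s) (1# - ratio ■ s)
  A⁺-factor s = when (addable? ρ⁺ s ×-dec colored? s) (1# - ratio s ■)
  A-factor  s = when (addable? ρ  s ×-dec colored? s) (1# - q * t * ratio ■ s)
  lhs s = nFactor D⁺ s * R⁺-factor s * R-factor s
  rhs s = nFactor D s * A⁺-factor s * A-factor s

  removed added : Box → Carrier
  removed s = when (removable? ρ s ×-dec colored? s) ((1# - q * t * ratio s ■) * (1# - ratio ■ s))
  added   s = when (addable? ρ s ×-dec colored? s) ((1# - ratio s ■) * (1# - q * t * ratio ■ s))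

  removed-≈1 : ∀ s → ¬ IsRemovable ρ s → removed s ≈ 1#
  removed-≈1 s ¬rem = when-no (removable? ρ s ×-dec colored? s) (¬rem ∘ proj₁) _

  added-≈1 : ∀ s → ¬ IsAddable ρ s → added s ≈ 1#
  added-≈1 s ¬add = when-no (addable? ρ s ×-dec colored? s) (¬add ∘ proj₁) _

  hookWeight-outside : ∀ {ρb a} κa b → ¬ a < ρb → hookWeight ρb κa a b ≈ 1#
  hookWeight-outside {ρb} {a} _ _ a≮ρb = when-no (a <? ρb) a≮ρb _

  -- Away from ■ the corners of colour i are the same for λ and λ ∪ ■.
  lhs-off-■ : ∀ {a b} → (a , b) ≢ ■ → lhs (a , b) ≈ nFactor D⁺ (a , b) * removed (a , b)
  lhs-off-■ {a} {b} s≢■ = trans (*-assoc _ _ _) (*-congˡ (when-merge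
    (removable? ρ⁺ (a , b) ×-dec colored? (a , b)) (removable? ρ (a , b) ×-dec colored? (a , b))
    (λ (rem , Cs) → to (removable⁺⇔removable s≢■ Cs) rem , Cs)
    (λ (rem , Cs) → from (removable⁺⇔removable s≢■ Cs) rem , Cs) _ _))

  rhs-off-■ : ∀ {a b} → (a , b) ≢ ■ → rhs (a , b) ≈ nFactor D (a , b) * added (a , b)
  rhs-off-■ {a} {b} s≢■ = trans (*-assoc _ _ _) (*-congˡ (when-merge
    (addable? ρ⁺ (a , b) ×-dec colored? (a , b)) (addable? ρ (a , b) ×-dec colored? (a , b))
    (λ (add , Cs) → to (addable⁺⇔addable s≢■ Cs) add , Cs)
    (λ (add , Cs) → from (addable⁺⇔addable s≢■ Cs) add , Cs) _ _))

  lower-left : ∀ {a b} → a < a₀ → b < b₀ → lhs (a , b) ≈ rhs (a , b)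
  lower-left {a} {b} a<a₀ b<b₀ = begin
    lhs (a , b)                          ≈⟨ lhs-off-■ (ℕP.<⇒≢ a<a₀ ∘ cong proj₁) ⟩
    nFactor D⁺ (a , b) * removed (a , b) ≈⟨ *-cong (reflexive (cong₂ (λ ρb κa → hookWeight ρb κa a b)
                                                      (ρ⁺-other (ℕP.<⇒≢ b<b₀)) (κ⁺-other (ℕP.<⇒≢ a<a₀))))
                                                   (removed-≈1 (a , b) (λ rem → proj₁ (proj₂ rem) 1+a<ρb)) ⟩
    nFactor D (a , b) * 1#               ≈⟨ *-congˡ (added-≈1 (a , b) (λ add → proj₁ add a<ρb)) ⟨
    nFactor D (a , b) * added (a , b)    ≈⟨ rhs-off-■ (ℕP.<⇒≢ a<a₀ ∘ cong proj₁) ⟨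
    rhs (a , b)                          ∎
    where
    1+a<ρb : suc a < ρ b
    1+a<ρb = ℕP.≤-<-trans a<a₀ (a₀<ρ b<b₀)
    a<ρb : a < ρ b
    a<ρb = ℕP.<-trans (ℕP.n<1+n a) 1+a<ρb

  private
    1%r≢0 : ¬ 1 % r ≡ 0
    1%r≢0 1%r≡0 with ≡.trans (≡.sym (m<n⇒m%n≡m 1<r)) 1%r≡0
    ... | ()

  corner : lhs ■ ≈ rhs ■
  corner = begin
    nFactor D⁺ ■ * R⁺-factor ■ * R-factor ■  ≈⟨ *-cong (*-cong N⁺■≈1 R⁺■≈x) R■≈1 ⟩
    1# * x * 1#                              ≈⟨ *-identityʳ _ ⟩
    1# * x                                   ≈⟨ *-congʳ (*-identityˡ 1#) ⟨
    1# * 1# * x                              ≈⟨ *-cong (*-cong N■≈1 A⁺■≈1) A■≈x ⟨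
    nFactor D ■ * A⁺-factor ■ * A-factor ■   ∎
    where
    x : Carrier
    x = 1# - q * t * ratio ■ ■
    ■∉D : ¬ a₀ < ρ b₀
    ■∉D = ∉-upper-right ℕP.≤-refl ℕP.≤-refl
    R⁺■≈x : R⁺-factor ■ ≈ x
    R⁺■≈x = when-yes (removable? ρ⁺ ■ ×-dec colored? ■) (■-removable⁺ , C■) x
    R■≈1 : R-factor ■ ≈ 1#
    R■≈1 = when-no (removable? ρ ■ ×-dec colored? ■) (■∉D ∘ proj₁ ∘ proj₁) _
    N■≈1 : nFactor D ■ ≈ 1#
    N■≈1 = hookWeight-outside (κ a₀) b₀ ■∉D
    A⁺■≈1 : A⁺-factor ■ ≈ 1#
    A⁺■≈1 = when-no (addable? ρ⁺ ■ ×-dec colored? ■) (λ (add , _) → proj₁ add (proj₁ ■-removable⁺)) _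
    A■≈x : A-factor ■ ≈ x
    A■≈x = when-yes (addable? ρ ■ ×-dec colored? ■) (■-addable , C■) x
    hook⁺■≡1 : hookLength (suc a₀) (suc b₀) a₀ b₀ ≡ 1
    hook⁺■≡1 = cong₂ (λ m n → m ∸ 1 ℕ.+ (n ∸ 1) ℕ.+ 1) (ℕP.m+n∸n≡m 1 a₀) (ℕP.m+n∸n≡m 1 b₀)
    N⁺■≈1 : nFactor D⁺ ■ ≈ 1#
    N⁺■≈1 = begin
      hookWeight (ρ⁺ b₀) (κ⁺ a₀) a₀ b₀      ≡⟨ cong₂ (λ ρb κa → hookWeight ρb κa a₀ b₀) ρ⁺-b₀ κ⁺-a₀ ⟩
      hookWeight (suc a₀) (suc b₀) a₀ b₀    ≈⟨ when-yes (a₀ <? suc a₀) (ℕP.n<1+n a₀) _ ⟩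
      when (hookLength (suc a₀) (suc b₀) a₀ b₀ % r ℕ.≟ 0) (hookFactor (suc a₀ ∸ a₀ ∸ 1) (suc b₀ ∸ b₀ ∸ 1))
                                            ≈⟨ when-no (hookLength (suc a₀) (suc b₀) a₀ b₀ % r ℕ.≟ 0)
                                                       (1%r≢0 ∘ ≡.subst (λ h → h % r ≡ 0) hook⁺■≡1) _ ⟩
      1#                                    ∎

  upper-right : ∀ {a b} → a₀ ≤ a → b₀ ≤ b → lhs (a , b) ≈ rhs (a , b)
  upper-right {a} {b} a₀≤a b₀≤b with ≡-dec ℕ._≟_ ℕ._≟_ (a , b) ■
  ... | yes ≡.refl = corner
  ... | no s≢■   = begin
    lhs (a , b)                          ≈⟨ lhs-off-■ s≢■ ⟩
    nFactor D⁺ (a , b) * removed (a , b) ≈⟨ *-cong (hookWeight-outside (κ⁺ a) b (∉⁺-upper-right a₀≤a b₀≤b s≢■))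
                                                   (removed-≈1 (a , b) (∉-upper-right a₀≤a b₀≤b ∘ proj₁)) ⟩
    1# * 1#                              ≈⟨ *-cong (hookWeight-outside (κ a) b (∉-upper-right a₀≤a b₀≤b))
                                                   (added-≈1 (a , b) (¬addable-upper-right a₀≤a b₀≤b s≢■)) ⟨
    nFactor D (a , b) * added (a , b)    ≈⟨ rhs-off-■ s≢■ ⟨
    rhs (a , b)                          ∎

  hookWeight-shift : ∀ ρb κa a b → hookWeight ρb κa a b ≈ hookWeight (suc ρb) κa (suc a) b
  hookWeight-shift ρb κa a b = when-cong (a <? ρb) (suc a <? suc ρb) s≤s ℕP.≤-pred refl

  -- The hook length of (k , b₀) is the content of the top box of column k minus that of ■, so it
  -- is divisible by r exactly when that removable corner has colour i.
  removable-top : ∀ {k} → k < a₀ → IsRemovable ρ (k , κ k ∸ 1) → removed (k , κ k ∸ 1) ≈ nFactor D (k , b₀)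
  removable-top {k} k<a₀ rem = begin
    removed (k , κ k ∸ 1)
      ≈⟨ when-cong (removable? ρ (k , κ k ∸ 1) ×-dec colored? (k , κ k ∸ 1)) (hookLength a₀ (κ k) k b₀ % r ℕ.≟ 0)
                   (to (isClass apart C■) ∘ proj₂) ((rem ,_) ∘ from (isClass apart C■))
                   (removable-corner-factor k<a₀ b₀<κk) ⟩
    when (hookLength a₀ (κ k) k b₀ % r ℕ.≟ 0) (hookFactor (a₀ ∸ k ∸ 1) (κ k ∸ b₀ ∸ 1))
      ≈⟨ when-yes (k <? a₀) k<a₀ _ ⟨
    hookWeight a₀ (κ k) k b₀
      ≡⟨ cong (λ ρb → hookWeight ρb (κ k) k b₀) ρ-b₀ ⟨
    nFactor D (k , b₀) ∎
    where
    b₀<κk : b₀ < κ k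
    b₀<κk = b₀<κ k<a₀
    apart : Apart (hookLength a₀ (κ k) k b₀) (content ■) (content (k , κ k ∸ 1))
    apart = up (hookLength-content k<a₀ b₀<κk)

  addable-top : ∀ {k} → k < a₀ → IsAddable ρ (k , κ k) → added (k , κ k) ≈ nFactor D⁺ (k , b₀)
  addable-top {k} k<a₀ add = begin
    added (k , κ k)
      ≈⟨ when-cong (addable? ρ (k , κ k) ×-dec colored? (k , κ k)) (hookLength (suc a₀) (κ k) k b₀ % r ℕ.≟ 0)
                   (to (isClass apart C■) ∘ proj₂) ((add ,_) ∘ from (isClass apart C■))
                   (addable-corner-factor k<a₀ b₀<κk) ⟩
    when (hookLength (suc a₀) (κ k) k b₀ % r ℕ.≟ 0) (hookFactor (suc a₀ ∸ k ∸ 1) (κ k ∸ b₀ ∸ 1))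
      ≈⟨ when-yes (k <? suc a₀) (ℕP.m<n⇒m<1+n k<a₀) _ ⟨
    hookWeight (suc a₀) (κ k) k b₀
      ≡⟨ cong₂ (λ ρb κa → hookWeight ρb κa k b₀) ρ⁺-b₀ (κ⁺-other (ℕP.<⇒≢ k<a₀)) ⟨
    nFactor D⁺ (k , b₀) ∎
    where
    b₀<κk : b₀ < κ k
    b₀<κk = b₀<κ k<a₀
    apart : Apart (hookLength (suc a₀) (κ k) k b₀) (content ■) (content (k , κ k))
    apart = up (hookLength-content⁺ (ℕP.m<n⇒m<1+n k<a₀) b₀<κk)

  flat-top : ∀ {k} → suc k < a₀ → κ (suc k) ≡ κ k → nFactor D (k , b₀) ≈ nFactor D⁺ (suc k , b₀)
  flat-top {k} 1+k<a₀ κ≡ = begin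
    hookWeight (ρ b₀) (κ k) k b₀               ≡⟨ cong (λ ρb → hookWeight ρb (κ k) k b₀) ρ-b₀ ⟩
    hookWeight a₀ (κ k) k b₀                   ≈⟨ hookWeight-shift a₀ (κ k) k b₀ ⟩
    hookWeight (suc a₀) (κ k) (suc k) b₀       ≡⟨ cong₂ (λ ρb κa → hookWeight ρb κa (suc k) b₀) ρ⁺-b₀
                                                         (≡.trans (κ⁺-other (ℕP.<⇒≢ 1+k<a₀)) κ≡) ⟨
    hookWeight (ρ⁺ b₀) (κ⁺ (suc k)) (suc k) b₀ ∎

  N-row N⁺-row removed-top added-top : ℕ → Carrier
  N-row       k = nFactor D (k , b₀)
  N⁺-row      k = nFactor D⁺ (k , b₀)
  removed-top k = removed (k , κ k ∸ 1)
  added-top   k = added (k , κ k)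

  -- Either column k + 1 is lower than column k, and the removable corner on top of column k and
  -- the addable corner above column k + 1 contribute exactly the two hook factors; or they have
  -- the same height, there are no such corners, and the hook of (k , b₀) in λ equals that of
  -- (k + 1 , b₀) in λ ∪ ■.
  column-step : ∀ {k} → suc k < a₀ → N⁺-row (suc k) * removed-top k ≈ added-top (suc k) * N-row k
  column-step {k} 1+k<a₀ with κ (suc k) ℕ.≟ κ k
  ... | no κ≢ = *-cong (sym (addable-top 1+k<a₀ (above-addable (inj₂ κ[1+k]<κk) (ℕP.≤-<-trans z≤n (b₀<κ 1+k<a₀)))))
                       (removable-top k<a₀ (top-removable κ[1+k]<κk))
    where
    k<a₀ : k < a₀
    k<a₀ = ℕP.<-trans (ℕP.n<1+n k) 1+k<a₀
    κ[1+k]<κk : κ (suc k) < κ k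
    κ[1+k]<κk = ℕP.≤∧≢⇒< (κ-antitone (ℕP.n≤1+n k)) κ≢
  ... | yes κ≡ = begin
    N⁺-row (suc k) * removed-top k  ≈⟨ *-congˡ (removed-≈1 _ (top-¬removable (ℕP.≤-<-trans z≤n (b₀<κ k<a₀)) κ≡)) ⟩
    N⁺-row (suc k) * 1#             ≈⟨ *-identityʳ _ ⟩
    N⁺-row (suc k)                  ≈⟨ flat-top 1+k<a₀ κ≡ ⟨
    N-row k                         ≈⟨ *-identityˡ _ ⟨
    1# * N-row k                    ≈⟨ *-congʳ (added-≈1 _ (above-¬addable κ≡)) ⟨
    added-top (suc k) * N-row k     ∎
    where
    k<a₀ : k < a₀
    k<a₀ = ℕP.<-trans (ℕP.n<1+n k) 1+k<a₀

  row-telescope : ∏ a₀ N⁺-row * ∏ a₀ removed-top ≈ ∏ a₀ added-top * ∏ a₀ N-row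
  row-telescope = up-to ≡.refl
    where
    -- a₀ is a parameter, so the induction runs over an n known to equal a₀.
    up-to : ∀ {n} → n ≡ a₀ → ∏ n N⁺-row * ∏ n removed-top ≈ ∏ n added-top * ∏ n N-row
    up-to {zero}  _        = refl
    up-to {suc n} 1+n≡a₀ = ∏-telescope n N⁺-row removed-top added-top N-row
      (sym (addable-top 0<a₀ (above-addable (inj₁ ≡.refl) (ℕP.≤-<-trans z≤n (b₀<κ 0<a₀)))))
      (λ k k<n → column-step (≡.subst (suc k <_) 1+n≡a₀ (s≤s k<n)))
      (removable-top n<a₀ (top-removable κ[1+n]<κn))
      where
      0<a₀ : 0 < a₀
      0<a₀ = ≡.subst (0 <_) 1+n≡a₀ (s≤s z≤n)
      n<a₀ : n < a₀
      n<a₀ = ≡.subst (n <_) 1+n≡a₀ (ℕP.n<1+n n)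
      κ[1+n]<κn : κ (suc n) < κ n
      κ[1+n]<κn = ≡.subst (_< κ n) (≡.trans (≡.sym κ-a₀) (cong κ (≡.sym 1+n≡a₀))) (b₀<κ n<a₀)

  above : ℕ → ℕ → Carrier
  above M′ a = ∏ M′ (λ m → nFactor D (a , b₀ ℕ.+ suc m))

  module _ (M′ : ℕ) (κ₀<b₀+M : κ 0 < b₀ ℕ.+ suc M′) where

    private
      κ<b₀+M : ∀ a → κ a < b₀ ℕ.+ suc M′
      κ<b₀+M a = ℕP.≤-<-trans (κ-antitone z≤n) κ₀<b₀+M

    N⁺-column : ∀ {a} → a < a₀ → ∏ (suc M′) (λ m → nFactor D⁺ (a , b₀ ℕ.+ m)) ≈ N⁺-row a * above M′ a
    N⁺-column {a} a<a₀ = *-cong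
      (reflexive (cong (λ b → nFactor D⁺ (a , b)) (ℕP.+-identityʳ b₀)))
      (∏-cong M′ (λ m _ → reflexive (cong₂ (λ ρb κa → hookWeight ρb κa a (b₀ ℕ.+ suc m))
                                           (ρ⁺-other (ℕP.m+1+n≢m b₀)) (κ⁺-other (ℕP.<⇒≢ a<a₀)))))

    N-column : ∀ a → ∏ (suc M′) (λ m → nFactor D (a , b₀ ℕ.+ m)) ≈ N-row a * above M′ a
    N-column a = *-congʳ (reflexive (cong (λ b → nFactor D (a , b)) (ℕP.+-identityʳ b₀)))

    removed-column : ∀ {a} → a < a₀ → ∏ (suc M′) (λ m → removed (a , b₀ ℕ.+ m)) ≈ removed-top a
    removed-column {a} a<a₀ = ∏-single-offset (suc M′) b₀ (κ a ∸ 1) (λ b → removed (a , b))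
      (ℕP.<⇒≤pred (b₀<κ a<a₀)) (ℕP.≤-<-trans (ℕP.m∸n≤m (κ a) 1) (κ<b₀+M a))
      (λ m _ b≢top → removed-≈1 (a , b₀ ℕ.+ m) (b≢top ∘ removable⇒top))

    added-column : ∀ {a} → a < a₀ → ∏ (suc M′) (λ m → added (a , b₀ ℕ.+ m)) ≈ added-top a
    added-column {a} a<a₀ = ∏-single-offset (suc M′) b₀ (κ a) (λ b → added (a , b))
      (ℕP.<⇒≤ (b₀<κ a<a₀)) (κ<b₀+M a)
      (λ m _ b≢top → added-≈1 (a , b₀ ℕ.+ m) (b≢top ∘ addable⇒above))

    column-lhs : ∀ {a} → a < a₀ → ∏ (suc M′) (λ m → lhs (a , b₀ ℕ.+ m)) ≈ above M′ a * (N⁺-row a * removed-top a)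
    column-lhs {a} a<a₀ = begin
      ∏ (suc M′) (λ m → lhs (a , b₀ ℕ.+ m))
        ≈⟨ ∏-cong (suc M′) (λ m _ → lhs-off-■ {a} {b₀ ℕ.+ m} (ℕP.<⇒≢ a<a₀ ∘ cong proj₁)) ⟩
      ∏ (suc M′) (λ m → nFactor D⁺ (a , b₀ ℕ.+ m) * removed (a , b₀ ℕ.+ m))
        ≈⟨ ∏-* (suc M′) (λ m → nFactor D⁺ (a , b₀ ℕ.+ m)) (λ m → removed (a , b₀ ℕ.+ m)) ⟩
      ∏ (suc M′) (λ m → nFactor D⁺ (a , b₀ ℕ.+ m)) * ∏ (suc M′) (λ m → removed (a , b₀ ℕ.+ m))
        ≈⟨ *-cong (N⁺-column a<a₀) (removed-column a<a₀) ⟩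
      (N⁺-row a * above M′ a) * removed-top a
        ≈⟨ xy∙z≈y∙xz _ _ _ ⟩
      above M′ a * (N⁺-row a * removed-top a) ∎

    column-rhs : ∀ {a} → a < a₀ → ∏ (suc M′) (λ m → rhs (a , b₀ ℕ.+ m)) ≈ above M′ a * (added-top a * N-row a)
    column-rhs {a} a<a₀ = begin
      ∏ (suc M′) (λ m → rhs (a , b₀ ℕ.+ m))
        ≈⟨ ∏-cong (suc M′) (λ m _ → rhs-off-■ {a} {b₀ ℕ.+ m} (ℕP.<⇒≢ a<a₀ ∘ cong proj₁)) ⟩
      ∏ (suc M′) (λ m → nFactor D (a , b₀ ℕ.+ m) * added (a , b₀ ℕ.+ m))
        ≈⟨ ∏-* (suc M′) (λ m → nFactor D (a , b₀ ℕ.+ m)) (λ m → added (a , b₀ ℕ.+ m)) ⟩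
      ∏ (suc M′) (λ m → nFactor D (a , b₀ ℕ.+ m)) * ∏ (suc M′) (λ m → added (a , b₀ ℕ.+ m))
        ≈⟨ *-cong (N-column a) (added-column a<a₀) ⟩
      (N-row a * above M′ a) * added-top a
        ≈⟨ xy∙z≈y∙zx _ _ _ ⟩
      above M′ a * (added-top a * N-row a) ∎

    upper-left : ∏ a₀ (λ a → ∏ (suc M′) (λ m → lhs (a , b₀ ℕ.+ m)))
               ≈ ∏ a₀ (λ a → ∏ (suc M′) (λ m → rhs (a , b₀ ℕ.+ m)))
    upper-left = begin
      ∏ a₀ (λ a → ∏ (suc M′) (λ m → lhs (a , b₀ ℕ.+ m)))  ≈⟨ ∏-cong a₀ (λ _ → column-lhs) ⟩
      ∏ a₀ (λ a → above M′ a * (N⁺-row a * removed-top a)) ≈⟨ ∏-*-* a₀ _ _ _ ⟩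
      ∏ a₀ (above M′) * (∏ a₀ N⁺-row * ∏ a₀ removed-top)   ≈⟨ *-congˡ row-telescope ⟩
      ∏ a₀ (above M′) * (∏ a₀ added-top * ∏ a₀ N-row)     ≈⟨ ∏-*-* a₀ _ _ _ ⟨
      ∏ a₀ (λ a → above M′ a * (added-top a * N-row a))   ≈⟨ ∏-cong a₀ (λ _ → column-rhs) ⟨
      ∏ a₀ (λ a → ∏ (suc M′) (λ m → rhs (a , b₀ ℕ.+ m)))  ∎

module MonomialSwap {c ℓ : Level} (Rg : CommutativeRing c ℓ) (q q⁻¹ t t⁻¹ : CommutativeRing.Carrier Rg)
  (qq⁻¹≈1 : CommutativeRing._≈_ Rg (CommutativeRing._*_ Rg q q⁻¹) (CommutativeRing.1# Rg))
  (tt⁻¹≈1 : CommutativeRing._≈_ Rg (CommutativeRing._*_ Rg t t⁻¹) (CommutativeRing.1# Rg)) where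

  open CommutativeRing Rg
  open Expr Rg q q⁻¹ t t⁻¹ using (_^_; mono)
  module Eᵀ = Expr Rg t t⁻¹ q q⁻¹
  open Monomials Rg q q⁻¹ t t⁻¹ qq⁻¹≈1 tt⁻¹≈1 using (hookFactor; 1-‿cong)
  module Mᵀ = Monomials Rg t t⁻¹ q q⁻¹ tt⁻¹≈1 qq⁻¹≈1

  ^-swap : ∀ x k → x Eᵀ.^ k ≡ x ^ k
  ^-swap x zero    = ≡.refl
  ^-swap x (suc k) = cong (x *_) (^-swap x k)

  mono-swap : ∀ m n → Eᵀ.mono m n ≈ mono n m
  mono-swap (+ k)    (+ l)    = trans (*-comm _ _) (reflexive (cong₂ _*_ (^-swap q l) (^-swap t k)))
  mono-swap (+ k)    -[1+ l ] = trans (*-comm _ _) (reflexive (cong₂ _*_ (^-swap q⁻¹ (suc l)) (^-swap t k)))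
  mono-swap -[1+ k ] (+ l)    = trans (*-comm _ _) (reflexive (cong₂ _*_ (^-swap q l) (^-swap t⁻¹ (suc k))))
  mono-swap -[1+ k ] -[1+ l ] = trans (*-comm _ _) (reflexive (cong₂ _*_ (^-swap q⁻¹ (suc l)) (^-swap t⁻¹ (suc k))))

  hookFactor-swap : ∀ α β → Mᵀ.hookFactor β α ≈ hookFactor α β
  hookFactor-swap α β = trans (*-cong (1-‿cong (mono-swap (+ suc β) (ℤ.- + α)))
                                      (1-‿cong (mono-swap (ℤ.- + β) (+ suc α))))
                              (*-comm _ _)

module CornerIdentity {c ℓ : Level} (Rg : CommutativeRing c ℓ) (q q⁻¹ t t⁻¹ : CommutativeRing.Carrier Rg)
  (qq⁻¹≈1 : CommutativeRing._≈_ Rg (CommutativeRing._*_ Rg q q⁻¹) (CommutativeRing.1# Rg))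
  (tt⁻¹≈1 : CommutativeRing._≈_ Rg (CommutativeRing._*_ Rg t t⁻¹) (CommutativeRing.1# Rg))
  (r : ℕ) .{{_ : NonZero r}} (1<r : 1 < r)
  {C : ℤ → Set} (C? : Decidable C) (isClass : IsResidueClass r C)
  (K : CornerAddition) (C■ : C (content (CornerAddition.■ K))) where

  open CommutativeRing Rg
  open RangeProducts Rg
  open Monomials Rg q q⁻¹ t t⁻¹ qq⁻¹≈1 tt⁻¹≈1 using (1-‿cong)
  open MonomialSwap Rg q q⁻¹ t t⁻¹ qq⁻¹≈1 tt⁻¹≈1
  open CornerAddition K
  open CornerAdditionProperties K using (D⁺)
  open Diagram D
  open DiagramProperties D using (ρ-antitone; κ-antitone)
  open Equivalence
  open import Relation.Binary.Reasoning.Setoid setoid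

  private
    content-transpose : ∀ a b → ℤ.- content (b , a) ≡ content (a , b)
    content-transpose a b = neg-sub (+ a) (+ b)
      where
      neg-sub : ∀ A B → ℤ.- (A ℤ.- B) ≡ B ℤ.- A
      neg-sub = solve-∀

  module I = Quadrants Rg q q⁻¹ t t⁻¹ qq⁻¹≈1 tt⁻¹≈1 r 1<r C? isClass K C■
  -- Transposition exchanges q and t and negates contents.
  module Iᵀ = Quadrants Rg t t⁻¹ q q⁻¹ tt⁻¹≈1 qq⁻¹≈1 r 1<r (C? ∘ ℤ.-_) (IsResidueClass-neg isClass)
                       (transposeCorner K) (≡.subst C (≡.sym (content-transpose a₀ b₀)) C■)

  hookWeight-transpose : ∀ ρb κa a b → (a < ρb ⇔ b < κa) → Iᵀ.hookWeight κa ρb b a ≈ I.hookWeight ρb κa a b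
  hookWeight-transpose ρb κa a b a∈⇔b∈ =
    when-cong (b <? κa) (a <? ρb) (from a∈⇔b∈) (to a∈⇔b∈)
      (when-cong (hookLength κa ρb b a % r ℕ.≟ 0) (hookLength ρb κa a b % r ℕ.≟ 0)
        (≡.subst (λ h → h % r ≡ 0) hook≡) (≡.subst (λ h → h % r ≡ 0) (≡.sym hook≡))
        (hookFactor-swap (ρb ∸ a ∸ 1) (κa ∸ b ∸ 1)))
    where
    hook≡ : hookLength κa ρb b a ≡ hookLength ρb κa a b
    hook≡ = cong (ℕ._+ 1) (ℕP.+-comm (κa ∸ b ∸ 1) (ρb ∸ a ∸ 1))

  private
    when-transpose : ∀ {P Q : Set} a b (p? : Dec P) (q? : Dec Q) → P ⇔ Q → ∀ {x y} → x ≈ y →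
                     when (p? ×-dec C? (ℤ.- content (b , a))) x ≈ when (q? ×-dec C? (content (a , b))) y
    when-transpose a b p? q? P⇔Q = when-cong (p? ×-dec C? (ℤ.- content (b , a))) (q? ×-dec C? (content (a , b)))
      (λ (p , c) → to P⇔Q p , ≡.subst C (content-transpose a b) c)
      (λ (q , c) → from P⇔Q q , ≡.subst C (≡.sym (content-transpose a b)) c)

  lhs-transpose : ∀ a b → Iᵀ.lhs (b , a) ≈ I.lhs (a , b)
  lhs-transpose a b = *-cong (*-cong
    (hookWeight-transpose (ρ⁺ b) (κ⁺ a) a b (mk⇔ (Diagram.ρ⇒κ D⁺) (Diagram.κ⇒ρ D⁺)))
    (when-transpose a b (removable? κ⁺ (b , a)) (removable? ρ⁺ (a , b))
       (DiagramProperties.transpose-removable D⁺ a b)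
       (1-‿cong (*-cong (*-comm t q) (mono-swap (+ b ℤ.- + b₀) (+ a ℤ.- + a₀))))))
    (when-transpose a b (removable? κ (b , a)) (removable? ρ (a , b))
       (DiagramProperties.transpose-removable D a b)
       (1-‿cong (mono-swap (+ b₀ ℤ.- + b) (+ a₀ ℤ.- + a))))

  rhs-transpose : ∀ a b → Iᵀ.rhs (b , a) ≈ I.rhs (a , b)
  rhs-transpose a b = *-cong (*-cong
    (hookWeight-transpose (ρ b) (κ a) a b (mk⇔ ρ⇒κ κ⇒ρ))
    (when-transpose a b (addable? κ⁺ (b , a)) (addable? ρ⁺ (a , b))
       (DiagramProperties.transpose-addable D⁺ a b)
       (1-‿cong (mono-swap (+ b ℤ.- + b₀) (+ a ℤ.- + a₀)))))
    (when-transpose a b (addable? κ (b , a)) (addable? ρ (a , b))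
       (DiagramProperties.transpose-addable D a b)
       (1-‿cong (*-cong (*-comm t q) (mono-swap (+ b₀ ℤ.- + b) (+ a₀ ℤ.- + a)))))

  upper-left-quadrant : ∀ M′ → κ 0 < b₀ ℕ.+ suc M′ →
    ∏² a₀ (suc M′) (λ (a , b) → I.lhs (a , b₀ ℕ.+ b)) ≈ ∏² a₀ (suc M′) (λ (a , b) → I.rhs (a , b₀ ℕ.+ b))
  upper-left-quadrant M′ κ₀<b₀+M = begin
    ∏² a₀ (suc M′) (λ (a , b) → I.lhs (a , b₀ ℕ.+ b))
      ≈⟨ ∏²-by-columns a₀ (suc M′) (λ (a , b) → I.lhs (a , b₀ ℕ.+ b)) ⟩
    ∏ a₀ (λ a → ∏ (suc M′) (λ b → I.lhs (a , b₀ ℕ.+ b)))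
      ≈⟨ I.upper-left M′ κ₀<b₀+M ⟩
    ∏ a₀ (λ a → ∏ (suc M′) (λ b → I.rhs (a , b₀ ℕ.+ b)))
      ≈⟨ ∏²-by-columns a₀ (suc M′) (λ (a , b) → I.rhs (a , b₀ ℕ.+ b)) ⟨
    ∏² a₀ (suc M′) (λ (a , b) → I.rhs (a , b₀ ℕ.+ b)) ∎

  lower-right-quadrant : ∀ K′ → ρ 0 < a₀ ℕ.+ suc K′ →
    ∏² (suc K′) b₀ (λ (a , b) → I.lhs (a₀ ℕ.+ a , b)) ≈ ∏² (suc K′) b₀ (λ (a , b) → I.rhs (a₀ ℕ.+ a , b))
  lower-right-quadrant K′ ρ₀<a₀+K = begin
    ∏ b₀ (λ b → ∏ (suc K′) (λ a → I.lhs (a₀ ℕ.+ a , b)))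
      ≈⟨ ∏-cong b₀ (λ b _ → ∏-cong (suc K′) (λ a _ → lhs-transpose (a₀ ℕ.+ a) b)) ⟨
    ∏ b₀ (λ b → ∏ (suc K′) (λ a → Iᵀ.lhs (b , a₀ ℕ.+ a)))
      ≈⟨ Iᵀ.upper-left K′ ρ₀<a₀+K ⟩
    ∏ b₀ (λ b → ∏ (suc K′) (λ a → Iᵀ.rhs (b , a₀ ℕ.+ a)))
      ≈⟨ ∏-cong b₀ (λ b _ → ∏-cong (suc K′) (λ a _ → rhs-transpose (a₀ ℕ.+ a) b)) ⟩
    ∏ b₀ (λ b → ∏ (suc K′) (λ a → I.rhs (a₀ ℕ.+ a , b))) ∎

  private
    split : ∀ {k m} → k < m → k ℕ.+ suc (m ∸ suc k) ≡ m
    split {k} k<m = ≡.trans (ℕP.+-suc k _) (ℕP.m+[n∸m]≡n k<m)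

  identity : ∀ {m n} → ρ 0 < m → κ 0 < n → ∏² m n I.lhs ≈ ∏² m n I.rhs
  identity {m} {n} ρ₀<m κ₀<n = ≡.subst₂ (λ m n → ∏² m n I.lhs ≈ ∏² m n I.rhs) (split a₀<m) (split b₀<n) (begin
    ∏² (a₀ ℕ.+ suc K′) (b₀ ℕ.+ suc M′) I.lhs  ≈⟨ ∏²-quadrants a₀ (suc K′) b₀ (suc M′) I.lhs ⟩
    _                                        ≈⟨ *-cong (*-cong lower-left (lower-right-quadrant K′ ρ₀<a₀+K))
                                                       (*-cong (upper-left-quadrant M′ κ₀<b₀+M) upper-right) ⟩
    _                                        ≈⟨ ∏²-quadrants a₀ (suc K′) b₀ (suc M′) I.rhs ⟨
    ∏² (a₀ ℕ.+ suc K′) (b₀ ℕ.+ suc M′) I.rhs  ∎)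
    where
    a₀<m : a₀ < m
    a₀<m = ℕP.≤-<-trans (ℕP.≤-trans (ℕP.≤-reflexive (≡.sym ρ-b₀)) (ρ-antitone z≤n)) ρ₀<m
    b₀<n : b₀ < n
    b₀<n = ℕP.≤-<-trans (ℕP.≤-trans (ℕP.≤-reflexive (≡.sym κ-a₀)) (κ-antitone z≤n)) κ₀<n
    K′ M′ : ℕ
    K′ = m ∸ suc a₀
    M′ = n ∸ suc b₀
    ρ₀<a₀+K : ρ 0 < a₀ ℕ.+ suc K′
    ρ₀<a₀+K = ≡.subst (ρ 0 <_) (≡.sym (split a₀<m)) ρ₀<m
    κ₀<b₀+M : κ 0 < b₀ ℕ.+ suc M′
    κ₀<b₀+M = ≡.subst (κ 0 <_) (≡.sym (split b₀<n)) κ₀<n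
    lower-left : ∏² a₀ b₀ I.lhs ≈ ∏² a₀ b₀ I.rhs
    lower-left = ∏²-cong a₀ b₀ (λ a b a<a₀ b<b₀ → I.lower-left a<a₀ b<b₀)
    upper-right : ∏² (suc K′) (suc M′) (λ (a , b) → I.lhs (a₀ ℕ.+ a , b₀ ℕ.+ b))
                ≈ ∏² (suc K′) (suc M′) (λ (a , b) → I.rhs (a₀ ℕ.+ a , b₀ ℕ.+ b))
    upper-right = ∏²-cong (suc K′) (suc M′) (λ a b _ _ → I.upper-right (ℕP.m≤m+n a₀ a) (ℕP.m≤m+n b₀ b))

module ListProducts {c ℓ : Level} (Rg : CommutativeRing c ℓ) (q q⁻¹ t t⁻¹ : CommutativeRing.Carrier Rg) where

  open CommutativeRing Rg
  open Expr Rg q q⁻¹ t t⁻¹ using (prod)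
  open RangeProducts Rg

  prod-filter : ∀ {A : Set} {P : Pred A 0ℓ} (P? : Decidable P) (f : A → Carrier) xs →
                prod f (filter P? xs) ≈ prod (λ x → when (P? x) (f x)) xs
  prod-filter P? f []       = refl
  prod-filter P? f (x ∷ xs) with P? x
  ... | yes _ = *-congˡ (prod-filter P? f xs)
  ... | no  _ = trans (prod-filter P? f xs) (sym (*-identityˡ _))

  prod-++ : ∀ {A : Set} (f : A → Carrier) xs ys → prod f (xs ++ ys) ≈ prod f xs * prod f ys
  prod-++ f []       ys = sym (*-identityˡ _)
  prod-++ f (x ∷ xs) ys = trans (*-congˡ (prod-++ f xs ys)) (sym (*-assoc _ _ _))

  prod-concatMap : ∀ {A B : Set} (f : B → Carrier) (g : A → List B) xs →
                   prod f (concatMap g xs) ≈ prod (prod f ∘ g) xs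
  prod-concatMap f g []       = refl
  prod-concatMap f g (x ∷ xs) = trans (prod-++ f (g x) (concatMap g xs)) (*-congˡ (prod-concatMap f g xs))

  prod-map : ∀ {A B : Set} (f : B → Carrier) (g : A → B) xs → prod f (map g xs) ≈ prod (f ∘ g) xs
  prod-map f g []       = refl
  prod-map f g (x ∷ xs) = *-congˡ (prod-map f g xs)

  prod-cong : ∀ {A : Set} {f g : A → Carrier} xs → (∀ x → f x ≈ g x) → prod f xs ≈ prod g xs
  prod-cong []       f≈g = refl
  prod-cong (x ∷ xs) f≈g = *-cong (f≈g x) (prod-cong xs f≈g)

  prod-applyUpTo : ∀ (f : ℕ → Carrier) g n → prod f (applyUpTo g n) ≈ ∏ n (f ∘ g)
  prod-applyUpTo f g zero    = refl
  prod-applyUpTo f g (suc n) = *-congˡ (prod-applyUpTo f (g ∘ suc) n)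

  prod-rect : ∀ lam (h : Box → Carrier) → prod h (rect lam) ≈ ∏² (suc (row lam 0)) (suc (length lam)) h
  prod-rect lam h = trans (prod-concatMap h row-boxes (upTo (suc (length lam))))
    (trans (prod-cong (upTo (suc (length lam)))
              (λ b → trans (prod-map h (_, b) (upTo (suc (row lam 0))))
                           (prod-applyUpTo (λ a → h (a , b)) (λ a → a) (suc (row lam 0)))))
           (prod-applyUpTo (λ b → ∏ (suc (row lam 0)) (λ a → h (a , b))) (λ b → b) (suc (length lam))))
    where
    row-boxes : ℕ → List Box
    row-boxes b = map (_, b) (upTo (suc (row lam 0)))

module _ (lam : List ℕ) (p : IsPartition lam) where

  open DiagramProperties (partitionDiagram lam p) using (ρ-antitone)

  ∉-outside-rect : ∀ {a b} → suc (row lam 0) ≤ a ⊎ suc (length lam) ≤ b → ¬ a < row lam b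
  ∉-outside-rect (inj₁ 1+row₀≤a) a<row =
    ℕP.<-irrefl ≡.refl (ℕP.<-≤-trans (ℕP.<-≤-trans a<row (ρ-antitone z≤n)) (ℕP.≤-trans (ℕP.n≤1+n _) 1+row₀≤a))
  ∉-outside-rect {a} (inj₂ 1+len≤b) a<row =
    ℕP.n≮0 (≡.subst (a <_) (row-beyond-length lam (ℕP.≤-trans (ℕP.n≤1+n _) 1+len≤b)) a<row)

  ¬addable-outside-rect : ∀ {a b} → suc (row lam 0) ≤ a ⊎ suc (length lam) ≤ b → ¬ IsAddable (row lam) (a , b)
  ¬addable-outside-rect {suc a} (inj₁ 1+row₀≤1+a) (_ , inj₂ a<row , _) =
    ℕP.<-irrefl ≡.refl (ℕP.<-≤-trans (ℕP.<-≤-trans a<row (ρ-antitone z≤n)) (ℕP.≤-pred 1+row₀≤1+a))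
  ¬addable-outside-rect {a} {suc b} (inj₂ 1+len≤1+b) (_ , _ , inj₂ a<row) =
    ℕP.n≮0 (≡.subst (a <_) (row-beyond-length lam (ℕP.≤-pred 1+len≤1+b)) a<row)

module PartitionGrids {c ℓ : Level} (Rg : CommutativeRing c ℓ) (q q⁻¹ t t⁻¹ : CommutativeRing.Carrier Rg)
  (qq⁻¹≈1 : CommutativeRing._≈_ Rg (CommutativeRing._*_ Rg q q⁻¹) (CommutativeRing.1# Rg))
  (tt⁻¹≈1 : CommutativeRing._≈_ Rg (CommutativeRing._*_ Rg t t⁻¹) (CommutativeRing.1# Rg))
  (r : ℕ) .{{_ : NonZero r}} (1<r : 1 < r)
  (lam : List ℕ) (p : IsPartition lam) (i : Fin r) {a₀ b₀ : ℕ}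
  (addable : Addable lam (a₀ , b₀)) (colour : color r (a₀ , b₀) ≡ toℕ i) where

  open CommutativeRing Rg
  open Expr Rg q q⁻¹ t t⁻¹ using (N; prod; ratio)
  open RangeProducts Rg
  open ListProducts Rg q q⁻¹ t t⁻¹
  open CornerIdentity Rg q q⁻¹ t t⁻¹ qq⁻¹≈1 tt⁻¹≈1 r 1<r
         (λ d → d %ℕ r ℕ.≟ toℕ i) (Residues.%ℕ-isResidueClass r (toℕ<n i))
         (partitionCorner lam p addable) colour public
  open CornerAdditionProperties (partitionCorner lam p addable) using (D⁺)
  open I using (nFactor; R⁺-factor; R-factor; A⁺-factor; A-factor; lhs; rhs)

  lam⁺ : List ℕ
  lam⁺ = addBox lam (a₀ , b₀)
  m n : ℕ
  m = suc (row lam⁺ 0)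
  n = suc (length lam⁺)
  D : Diagram
  D = partitionDiagram lam p

  private
    grid-of-lam : ∀ (h : Box → Carrier) → (∀ a b → suc (row lam 0) ≤ a ⊎ suc (length lam) ≤ b → h (a , b) ≈ 1#) →
                  prod h (rect lam) ≈ ∏² m n h
    grid-of-lam h outside≈1 = trans (prod-rect lam h)
      (sym (∏²-truncate _ _ m n h (s≤s (row₀-addBox lam a₀ b₀)) (s≤s (length-addBox lam a₀ b₀)) outside≈1))

  lhs-grid : N r lam⁺ * prod (λ s → 1# - q * t * ratio s (a₀ , b₀)) (R r (toℕ i) lam⁺)
                      * prod (λ s → 1# - ratio (a₀ , b₀) s) (R r (toℕ i) lam)
             ≈ ∏² m n lhs
  lhs-grid = trans (*-cong (*-cong N⁺ R⁺) R′) (sym (∏²-*³ m n (nFactor D⁺) R⁺-factor R-factor))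
    where
    N⁺ : N r lam⁺ ≈ ∏² m n (nFactor D⁺)
    N⁺ = trans (prod-filter (λ s → hook lam⁺ s % r ℕ.≟ 0) _ (boxes lam⁺))
               (trans (prod-filter (_∈λ? lam⁺) _ (rect lam⁺)) (prod-rect lam⁺ (nFactor D⁺)))
    R⁺ : prod (λ s → 1# - q * t * ratio s (a₀ , b₀)) (R r (toℕ i) lam⁺) ≈ ∏² m n R⁺-factor
    R⁺ = trans (prod-filter (λ s → Removable? lam⁺ s ×-dec (color r s ℕ.≟ toℕ i)) _ (rect lam⁺))
               (prod-rect lam⁺ R⁺-factor)
    R′ : prod (λ s → 1# - ratio (a₀ , b₀) s) (R r (toℕ i) lam) ≈ ∏² m n R-factor
    R′ = trans (prod-filter (λ s → Removable? lam s ×-dec (color r s ℕ.≟ toℕ i)) _ (rect lam))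
               (grid-of-lam R-factor (λ a b out → when-no (Removable? lam (a , b) ×-dec (color r (a , b) ℕ.≟ toℕ i))
                                                          (∉-outside-rect lam p out ∘ proj₁ ∘ proj₁) _))

  rhs-grid : N r lam * prod (λ s → 1# - ratio s (a₀ , b₀)) (A r (toℕ i) lam⁺)
                     * prod (λ s → 1# - q * t * ratio (a₀ , b₀) s) (A r (toℕ i) lam)
             ≈ ∏² m n rhs
  rhs-grid = trans (*-cong (*-cong N′ A⁺) A′) (sym (∏²-*³ m n (nFactor D) A⁺-factor A-factor))
    where
    N′ : N r lam ≈ ∏² m n (nFactor D)
    N′ = trans (prod-filter (λ s → hook lam s % r ℕ.≟ 0) _ (boxes lam))
               (trans (prod-filter (_∈λ? lam) _ (rect lam))
                      (grid-of-lam (nFactor D) (λ a b out → I.hookWeight-outside (col lam a) b (∉-outside-rect lam p out))))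
    A⁺ : prod (λ s → 1# - ratio s (a₀ , b₀)) (A r (toℕ i) lam⁺) ≈ ∏² m n A⁺-factor
    A⁺ = trans (prod-filter (λ s → Addable? lam⁺ s ×-dec (color r s ℕ.≟ toℕ i)) _ (rect lam⁺))
               (prod-rect lam⁺ A⁺-factor)
    A′ : prod (λ s → 1# - q * t * ratio (a₀ , b₀) s) (A r (toℕ i) lam) ≈ ∏² m n A-factor
    A′ = trans (prod-filter (λ s → Addable? lam s ×-dec (color r s ℕ.≟ toℕ i)) _ (rect lam))
               (grid-of-lam A-factor (λ a b out → when-no (Addable? lam (a , b) ×-dec (color r (a , b) ℕ.≟ toℕ i))
                                                          (¬addable-outside-rect lam p out ∘ proj₁) _))

  ρ₀<m : row lam 0 < m
  ρ₀<m = s≤s (row₀-addBox lam a₀ b₀)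

  κ₀<n : col lam 0 < n
  κ₀<n = s≤s (ℕP.≤-trans (col≤length lam 0) (length-addBox lam a₀ b₀))

lemmaA5 : {c ℓ : Level} (Rg : CommutativeRing c ℓ)
  (q q⁻¹ t t⁻¹ : CommutativeRing.Carrier Rg) →
  let open CommutativeRing Rg
      open Expr Rg q q⁻¹ t t⁻¹
  in q * q⁻¹ ≈ 1# → t * t⁻¹ ≈ 1# →
     (r : ℕ) .{{_ : NonZero r}} → 1 < r →
     (lam : List ℕ) → IsPartition lam →
     (i : Fin r) (bb : Box) → Addable lam bb → color r bb ≡ toℕ i →
     N r (addBox lam bb)
       * prod (λ s → 1# - q * t * ratio s bb) (R r (toℕ i) (addBox lam bb))
       * prod (λ s → 1# - ratio bb s) (R r (toℕ i) lam)
     ≈ N r lam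
       * prod (λ s → 1# - ratio s bb) (A r (toℕ i) (addBox lam bb))
       * prod (λ s → 1# - q * t * ratio bb s) (A r (toℕ i) lam)
lemmaA5 Rg q q⁻¹ t t⁻¹ qq⁻¹≈1 tt⁻¹≈1 r 1<r lam p i (a₀ , b₀) addable colour = begin
  _            ≈⟨ lhs-grid ⟩
  ∏² m n I.lhs ≈⟨ identity ρ₀<m κ₀<n ⟩
  ∏² m n I.rhs ≈⟨ rhs-grid ⟨
  _            ∎
  where
  open CommutativeRing Rg using (setoid)
  open import Relation.Binary.Reasoning.Setoid setoid
  open RangeProducts Rg using (∏²)
  open PartitionGrids Rg q q⁻¹ t t⁻¹ qq⁻¹≈1 tt⁻¹≈1 r 1<r lam p i addable colour
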